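{- Let $\{U_n\}_{n\ge0}$ be defined by $U_0=0$, $U_1=1$, $U_{n+2}=6U_{n+1}-U_n$. For $n\ge1$ let $\mathcal D_1(n)$ be the smallest positive integer $m$ such that $U_0,\ldots,U_{n-1}$ are pairwise incongruent modulo $m$, and for a positive integer $m$ let $z(m)$ be the smallest $n\ge1$ with $m\mid U_n$. Let $n>1$ and $m=\mathcal D_1(n)$. Then: (i) $m$ has at most one odd prime divisor; (ii) if $m$ is divisible by exactly one odd prime $p$, then $\big(\frac{2}{p}\big)=-1$ and $z(p)=(p+1)/2$; (iii) if $m$ is not a power of $2$, then $m=2^ap^b$ with $a,b\ge1$ and $p$ a prime with $p\equiv5\pmod 8$.
   Context: $\big(\frac{2}{p}\big)$ denotes the Legendre symbol. -}

module Defs where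

open import Data.Nat as ℕ using (ℕ; zero; suc; _<_; _≤_)
open import Data.Integer as ℤ using (ℤ; +_; -[1+_])
open import Data.Integer.Divisibility using () renaming (_∣_ to _∣ℤ_)
open import Data.Nat.Divisibility using (_∣_)
open import Data.Nat.Primality using (Prime)
open import Data.Product using (∃; _×_)
open import Relation.Nullary using (¬_)
open import Relation.Binary.PropositionalEquality using (_≡_; _≢_)

U : ℕ → ℤ
U zero = + 0
U (suc zero) = + 1
U (suc (suc n)) = (+ 6) ℤ.* U (suc n) ℤ.- U n

_≡_[mod_] : ℤ → ℤ → ℕ → Set
a ≡ b [mod m ] = (+ m) ∣ℤ (a ℤ.- b)

PairwiseIncongruent : ℕ → ℕ → Set
PairwiseIncongruent n m =
  ∀ i j → i < n → j < n → i ≢ j → ¬ (U i ≡ U j [mod m ])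

IsD₁ : ℕ → ℕ → Set
IsD₁ n m = 1 ≤ m × PairwiseIncongruent n m
         × (∀ m′ → 1 ≤ m′ → PairwiseIncongruent n m′ → m ≤ m′)

IsZ : ℕ → ℕ → Set
IsZ m k = 1 ≤ k × (+ m) ∣ℤ U k × (∀ k′ → 1 ≤ k′ → (+ m) ∣ℤ U k′ → k ≤ k′)

QuadRes : ℤ → ℕ → Set
QuadRes a p = ∃ λ (x : ℤ) → (x ℤ.* x) ≡ a [mod p ]

-- Legendre symbol (a/p) = s, as a relation (for p an odd prime)
data Legendre (a : ℤ) (p : ℕ) : ℤ → Set where
  leg-zero : (+ p) ∣ℤ a → Legendre a p (+ 0)
  leg-res  : ¬ ((+ p) ∣ℤ a) → QuadRes a p → Legendre a p (+ 1)
  leg-non  : ¬ ((+ p) ∣ℤ a) → ¬ QuadRes a p → Legendre a p -[1+ 0 ]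

OddPrime : ℕ → Set
OddPrime p = Prime p × p ℕ.% 2 ≡ 1

module Submission where

-- U k is the √2-part of (3 + 2√2)ᵏ = A k + 2 U k √2, and the proof combines three facts about U
-- with the minimality of m:
--  * 2-adic rigidity: U (j + t) ≡ U j (mod 2ᵉ) forces 2ᵉ ∣ t, so comparing with the power of two
--    in [n, 2n) gives m ≤ 2 (n - 1); a zero N ≥ 1 of U modulo m must have N ≥ n, hence 2N > m,
--    and if moreover A N ≡ -1 (mod m) then N ≥ m, by the reflection U (N - i) ≡ U i;
--  * U is a divisibility sequence with lifting (d ∣ U k ⇒ dʲ⁺¹ ∣ U (dʲ k)), and every t divides
--    some U K with K ≤ t;
--  * Frobenius in ℤ[√2]: an odd prime p = 2h + 1 divides U h if 2ʰ ≡ 1 (mod p), and divides U (h+1)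
--    with A (h+1) ≡ -1 if 2ʰ ≡ -1; Frobenius in ℤ[i] gives 2ʰ ≡ 1 when p ≡ ±1 (mod 8).
-- Building small zeros of m from zeros of its prime-power parts then rules out 2ʰ ≡ 1 for odd
-- p ∣ m (giving (ii)), two distinct odd primes (i), odd prime powers and p ≡ 1, 3, 7 (mod 8) (iii).

open import Defs

module PrimePowers where

  open import Data.Nat
  open import Data.Nat.Properties
  open import Data.Nat.Divisibility
  open import Data.Nat.Primality
  open import Data.Nat.Primality.Factorisation using (factorise)
  open import Data.Nat.Induction using (<-rec)
  import Data.Nat.Tactic.RingSolver as NatSolver
  open import Data.List using ([]; _∷_)
  open import Data.Nat.ListAction using (product)
  open import Data.List.Relation.Unary.All using (_∷_)
  open import Data.Product
  open import Data.Sum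
  open import Data.Empty
  open import Relation.Nullary
  open import Relation.Binary.PropositionalEquality

  primeDivisor : ∀ n → 1 < n → ∃ λ p → Prime p × p ∣ n
  primeDivisor n@(suc _) 1<n with factorise n
  ... | record { factors = [] ; isFactorisation = n≡1 } = ⊥-elim (<-irrefl (sym n≡1) 1<n)
  ... | record { factors = p ∷ ps ; isFactorisation = n≡p*Πps ; factorsPrime = pp ∷ _ } =
    p , pp , divides (product ps) (trans n≡p*Πps (*-comm p (product ps)))

  noPrimeDivisor⇒≡1 : ∀ n → 1 ≤ n → (∀ q → Prime q → ¬ q ∣ n) → n ≡ 1
  noPrimeDivisor⇒≡1 n 1≤n free with 1 <? n
  ... | yes 1<n = let (q , pq , q∣n) = primeDivisor n 1<n in ⊥-elim (free q pq q∣n)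
  ... | no  1≮n = ≤-antisym (≮⇒≥ 1≮n) 1≤n

  primeDivisorOfPower : ∀ {p q} → Prime p → Prime q → ∀ b → q ∣ p ^ b → q ≡ p
  primeDivisorOfPower pp pq zero q∣1 = ⊥-elim (¬prime[1] (subst Prime (∣1⇒≡1 q∣1) pq))
  primeDivisorOfPower {p} pp pq (suc b) q∣p^b+1 with euclidsLemma p (p ^ b) pq q∣p^b+1
  ... | inj₂ q∣p^b = primeDivisorOfPower pp pq b q∣p^b
  ... | inj₁ q∣p with prime⇒irreducible pp q∣p
  ...   | inj₂ q≡p = q≡p
  ...   | inj₁ q≡1 = ⊥-elim (¬prime[1] (subst Prime q≡1 pq))

  primePower-cancelʳ : ∀ {p o} → Prime p → ¬ p ∣ o → ∀ k x → p ^ k ∣ x * o → p ^ k ∣ x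
  primePower-cancelʳ pp p∤o zero x _ = 1∣ x
  primePower-cancelʳ {p} {o} pp p∤o (suc k) x p^k+1∣xo
    with euclidsLemma x o pp (∣-trans (m∣m*n (p ^ k)) p^k+1∣xo)
  ... | inj₂ p∣o = ⊥-elim (p∤o p∣o)
  ... | inj₁ (divides q refl) =
    subst (p ^ suc k ∣_) (*-comm p q) (*-monoʳ-∣ p (primePower-cancelʳ pp p∤o k q p^k∣qo))
    where
    instance _ = prime⇒nonZero pp
    p^k∣qo : p ^ k ∣ q * o
    p^k∣qo = *-cancelˡ-∣ p (subst (p ^ suc k ∣_) (regroup q p o) p^k+1∣xo)
      where
      regroup : ∀ q p o → q * p * o ≡ p * (q * o)
      regroup = NatSolver.solve-∀

  primePower-∣-product : ∀ {p y x} → Prime p → ¬ p ∣ y → ∀ k → p ^ k ∣ x → y ∣ x → p ^ k * y ∣ x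
  primePower-∣-product {p} {y} pp p∤y k p^k∣x (divides q refl) =
    *-monoˡ-∣ y (primePower-cancelʳ pp p∤y k q p^k∣x)

  cofactor-< : ∀ {t q p} → 0 < t → t ≡ q * p → 1 < p → 0 < q × q < t
  cofactor-< {q = zero}  0<t t≡0 _   = ⊥-elim (<-irrefl (sym t≡0) 0<t)
  cofactor-< {q = suc q} {p} _ t≡qp 1<p = z<s , subst (suc q <_) (sym t≡qp) (m<m*n (suc q) p 1<p)

  factorOut : ∀ {p} → Prime p → ∀ m → 0 < m → ∃₂ λ b t → m ≡ p ^ b * t × ¬ p ∣ t × 0 < t
  factorOut {p} pp = <-rec Split step
    where
    Split : ℕ → Set
    Split m = 0 < m → ∃₂ λ b t → m ≡ p ^ b * t × ¬ p ∣ t × 0 < t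
    step : ∀ m → (∀ {m′} → m′ < m → Split m′) → Split m
    step m rec 0<m with p ∣? m
    ... | no p∤m = 0 , m , sym (*-identityˡ m) , p∤m , 0<m
    ... | yes (divides q m≡qp) =
      let (0<q , q<m) = cofactor-< {q = q} 0<m m≡qp (nonTrivial⇒n>1 p ⦃ prime⇒nonTrivial pp ⦄)
          (b , t , q≡p^bt , p∤t , 0<t) = rec q<m 0<q in
      suc b , t , trans m≡qp (trans (cong (_* p) q≡p^bt) (reassoc (p ^ b) t)) , p∤t , 0<t
      where
      reassoc : ∀ x t → x * t * p ≡ p * x * t
      reassoc x t = trans (*-comm (x * t) p) (sym (*-assoc p x t))

  factorOut-∣ : ∀ {p m} → Prime p → p ∣ m → 0 < m → ∃₂ λ b t → m ≡ p ^ suc b * t × ¬ p ∣ t × 0 < t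
  factorOut-∣ {p} {m} pp p∣m 0<m with factorOut pp m 0<m
  ... | zero  , t , m≡t , p∤t , _ = ⊥-elim (p∤t (subst (p ∣_) (trans m≡t (*-identityˡ t)) p∣m))
  ... | suc b , t , m≡p^b+1t , p∤t , 0<t = b , t , m≡p^b+1t , p∤t , 0<t

module Parity where

  open import Data.Nat
  open import Data.Nat.Properties
  open import Data.Nat.Divisibility
  open import Data.Nat.Primality
  import Data.Nat.Tactic.RingSolver as NatSolver
  open import Data.Product
  open import Data.Sum
  open import Data.Empty
  open import Relation.Nullary
  open import Relation.Binary.PropositionalEquality

  halve : ∀ t → (∃ λ d → t ≡ d + d) ⊎ (∃ λ d → t ≡ suc (d + d))
  halve zero    = inj₁ (0 , refl)
  halve (suc t) with halve t
  ... | inj₁ (d , t≡2d)   = inj₂ (d , cong suc t≡2d)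
  ... | inj₂ (d , t≡2d+1) = inj₁ (suc d , cong suc (trans t≡2d+1 (sym (+-suc d d))))

  prime-2-or-odd : ∀ {p} → Prime p → p ≡ 2 ⊎ ∃ λ h → p ≡ suc (2 * h) × 1 ≤ h
  prime-2-or-odd {p} pp with halve p
  ... | inj₁ (d , p≡d+d) with prime⇒irreducible pp (divides d (trans p≡d+d (double d)))
    where
    double : ∀ d → d + d ≡ d * 2
    double = NatSolver.solve-∀
  ...   | inj₁ 2≡1 = ⊥-elim (1+n≢n 2≡1)
  ...   | inj₂ 2≡p = inj₁ (sym 2≡p)
  prime-2-or-odd pp | inj₂ (zero  , refl) = ⊥-elim (¬prime[1] pp)
  prime-2-or-odd pp | inj₂ (suc d , refl) = inj₂ (suc d , cong suc (cong (suc d +_) (sym (+-identityʳ (suc d)))) , s≤s z≤n)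

  oddPrime⇒2h+1 : ∀ {p} → OddPrime p → ∃ λ h → p ≡ suc (2 * h) × 1 ≤ h
  oddPrime⇒2h+1 (pp , p%2≡1) with prime-2-or-odd pp
  ... | inj₁ refl with p%2≡1
  ...   | ()
  oddPrime⇒2h+1 (pp , _) | inj₂ p≡2h+1 = p≡2h+1

  odd-^ : ∀ h b → ∃ λ j → suc (2 * h) ^ b ≡ suc (2 * j)
  odd-^ h zero    = 0 , refl
  odd-^ h (suc b) with odd-^ h b
  ... | j , eq = 2 * h * j + h + j , trans (cong (suc (2 * h) *_) eq) (product h j)
    where
    product : ∀ h j → suc (2 * h) * suc (2 * j) ≡ suc (2 * (2 * h * j + h + j))
    product = NatSolver.solve-∀

  residue-mod-4 : ∀ h → ∃ λ t → h ≡ 4 * t ⊎ h ≡ 4 * t + 1 ⊎ h ≡ 4 * t + 2 ⊎ h ≡ 4 * t + 3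
  residue-mod-4 zero    = 0 , inj₁ refl
  residue-mod-4 (suc h) with residue-mod-4 h
  ... | t , inj₁ refl               = t , inj₂ (inj₁ (+-comm 1 (4 * t)))
  ... | t , inj₂ (inj₁ refl)        = t , inj₂ (inj₂ (inj₁ (sym (+-suc (4 * t) 1))))
  ... | t , inj₂ (inj₂ (inj₁ refl)) = t , inj₂ (inj₂ (inj₂ (sym (+-suc (4 * t) 2))))
  ... | t , inj₂ (inj₂ (inj₂ refl)) = suc t , inj₁ (wrap t)
    where
    wrap : ∀ t → suc (4 * t + 3) ≡ 4 * suc t
    wrap = NatSolver.solve-∀

  odd-product : ∀ x y → 1 ≤ x → 1 ≤ y → 2 * suc x * suc y ≤ suc (2 * x) * suc (2 * y)
  odd-product (suc x) (suc y) _ _ = ≤-trans (m≤m+n _ _) (≤-reflexive (sym (expand x y)))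
    where
    expand : ∀ x y → suc (2 * suc x) * suc (2 * suc y)
                   ≡ 2 * suc (suc x) * suc (suc y) + (2 * x * y + 2 * x + 2 * y + 1)
    expand = NatSolver.solve-∀

  n<2^n : ∀ n → n < 2 ^ n
  n<2^n zero    = z<s
  n<2^n (suc n) = subst₂ _≤_ (+-comm (suc n) 1) (cong (2 ^ n +_) (sym (+-identityʳ (2 ^ n))))
                    (+-mono-≤ (n<2^n n) (m^n>0 2 n))

  power-of-two-bracket : ∀ j → 1 ≤ j → ∃ λ e → 2 ^ e ≤ j × j < 2 ^ suc e
  power-of-two-bracket j 1≤j = search j (n<2^n j)
    where
    search : ∀ k → j < 2 ^ k → ∃ λ e → 2 ^ e ≤ j × j < 2 ^ suc e
    search zero    j<1 = ⊥-elim (<⇒≱ j<1 1≤j)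
    search (suc k) j<2^k+1 with j <? 2 ^ k
    ... | yes j<2^k = search k j<2^k
    ... | no  j≮2^k = k , ≮⇒≥ j≮2^k , j<2^k+1

module IntegerDivisibility where

  open import Data.Integer hiding (suc; pred)
  open import Data.Integer.Properties using (abs-*; ^-*-assoc; ^-zeroˡ; *-identityʳ)
  open import Data.Integer.Divisibility.Signed
  import Data.Nat as ℕ
  open import Data.Nat using (zero; suc)
  import Data.Nat.Divisibility as ℕ
  open import Data.Nat.Primality using (Prime; euclidsLemma)
  open import Data.Sum using (_⊎_; map)
  open import Relation.Nullary using (¬_)
  open import Relation.Binary.PropositionalEquality using (_≡_; refl; sym; trans; cong; subst)
  open import Data.Integer.Tactic.RingSolver using (solve-∀)
  open PrimePowers

  euclidsLemmaℤ : ∀ {p} x y → Prime p → + p ∣ x * y → (+ p ∣ x) ⊎ (+ p ∣ y)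
  euclidsLemmaℤ {p} x y pp p∣xy =
    map ∣ᵤ⇒∣ ∣ᵤ⇒∣ (euclidsLemma ∣ x ∣ ∣ y ∣ pp (subst (p ℕ.∣_) (abs-* x y) (∣⇒∣ᵤ p∣xy)))

  primePower-cancelʳℤ : ∀ {p o} → Prime p → ¬ (+ p ∣ o) → ∀ k x → + (p ℕ.^ k) ∣ x * o → + (p ℕ.^ k) ∣ x
  primePower-cancelʳℤ {p} {o} pp p∤o k x h =
    ∣ᵤ⇒∣ (primePower-cancelʳ pp (λ p∣o → p∤o (∣ᵤ⇒∣ p∣o)) k ∣ x ∣
            (subst (p ℕ.^ k ℕ.∣_) (abs-* x o) (∣⇒∣ᵤ h)))

  primePower-∣-productℤ : ∀ {p y X} → Prime p → ¬ p ℕ.∣ y → ∀ k →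
                          + (p ℕ.^ k) ∣ X → + y ∣ X → + (p ℕ.^ k ℕ.* y) ∣ X
  primePower-∣-productℤ pp p∤y k p^k∣X y∣X =
    ∣ᵤ⇒∣ (primePower-∣-product pp p∤y k (∣⇒∣ᵤ p^k∣X) (∣⇒∣ᵤ y∣X))

  *-cong-mod : ∀ {d} a a′ c c′ → d ∣ a - a′ → d ∣ c - c′ → d ∣ a * c - a′ * c′
  *-cong-mod {d} a a′ c c′ h₁ h₂ =
    subst (d ∣_) (sym (identity a a′ c c′)) (∣m∣n⇒∣m+n (∣n⇒∣m*n a h₂) (∣m⇒∣m*n c′ h₁))
    where
    identity : ∀ a a′ c c′ → a * c - a′ * c′ ≡ a * (c - c′) + (a - a′) * c′
    identity = solve-∀

  ^-cong-mod : ∀ {d} x y n → d ∣ x - y → d ∣ x ^ n - y ^ n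
  ^-cong-mod x y zero    _ = divides (+ 0) refl
  ^-cong-mod x y (suc n) h = *-cong-mod x y (x ^ n) (y ^ n) h (^-cong-mod x y n h)

  ^-double : ∀ x k → x ^ (2 ℕ.* k) ≡ (x * x) ^ k
  ^-double x k = trans (sym (^-*-assoc x 2 k)) (cong (λ y → (x * y) ^ k) (*-identityʳ x))

  [-1]^odd : ∀ k → -[1+ 0 ] ^ suc (2 ℕ.* k) ≡ -[1+ 0 ]
  [-1]^odd k = cong (-[1+ 0 ] *_) (trans (^-double -[1+ 0 ] k) (^-zeroˡ k))

module Sequence where

  open import Data.Integer hiding (suc; pred)
  open import Data.Integer.Properties
  open import Data.Integer.Tactic.RingSolver using (solve-∀)
  open import Data.Integer.Divisibility.Signed
  import Data.Nat as ℕ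
  import Data.Nat.Properties as ℕ
  import Data.Nat.Divisibility as ℕ
  open import Data.Nat using (ℕ; zero; suc)
  open import Data.Nat.Primality using (Prime)
  open import Data.Product using (∃₂; _×_; _,_; proj₁; proj₂)
  open import Relation.Nullary using (¬_)
  open import Relation.Binary.PropositionalEquality
  open IntegerDivisibility

  -- The companion sequence: (3 + 2√2)ⁿ = A n + 2 U n √2.
  A : ℕ → ℤ
  A n = U (suc n) - + 3 * U n

  U-suc : ∀ n → U (suc n) ≡ A n + + 3 * U n
  U-suc n = identity (U (suc n)) (U n)
    where
    identity : ∀ x y → x ≡ (x - + 3 * y) + + 3 * y
    identity = solve-∀

  A-suc : ∀ n → A (suc n) ≡ + 3 * A n + + 8 * U n
  A-suc n = identity (U (suc n)) (U n)
    where
    identity : ∀ x y → (+ 6 * x - y) - + 3 * x ≡ + 3 * (x - + 3 * y) + + 8 * y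
    identity = solve-∀

  -- Addition formulas, i.e. multiplicativity of (3 + 2√2)ⁿ.
  +-formulas : ∀ a b → (U (a ℕ.+ b) ≡ A a * U b + U a * A b)
                     × (A (a ℕ.+ b) ≡ A a * A b + + 8 * (U a * U b))
  +-formulas zero b = identityU (U b) (A b) , identityA (A b) (U b)
    where
    identityU : ∀ u a → u ≡ + 1 * u + + 0 * a
    identityU = solve-∀
    identityA : ∀ a u → a ≡ + 1 * a + + 8 * (+ 0 * u)
    identityA = solve-∀
  +-formulas (suc a) b = U-step , A-step
    where
    open ≡-Reasoning
    ih : (U (a ℕ.+ b) ≡ A a * U b + U a * A b) × (A (a ℕ.+ b) ≡ A a * A b + + 8 * (U a * U b))
    ih = +-formulas a b
    U-step : U (suc a ℕ.+ b) ≡ A (suc a) * U b + U (suc a) * A b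
    U-step = begin
      U (suc (a ℕ.+ b))                                          ≡⟨ U-suc (a ℕ.+ b) ⟩
      A (a ℕ.+ b) + + 3 * U (a ℕ.+ b)                            ≡⟨ cong₂ (λ x y → x + + 3 * y) (proj₂ ih) (proj₁ ih) ⟩
      (A a * A b + + 8 * (U a * U b)) + + 3 * (A a * U b + U a * A b)
                                                                 ≡⟨ regroupU (A a) (A b) (U a) (U b) ⟩
      (+ 3 * A a + + 8 * U a) * U b + (A a + + 3 * U a) * A b    ≡⟨ cong₂ (λ x y → x * U b + y * A b) (A-suc a) (U-suc a) ⟨
      A (suc a) * U b + U (suc a) * A b                          ∎
      where
      regroupU : ∀ a b c d → (a * b + + 8 * (c * d)) + + 3 * (a * d + c * b)
                           ≡ (+ 3 * a + + 8 * c) * d + (a + + 3 * c) * b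
      regroupU = solve-∀
    A-step : A (suc a ℕ.+ b) ≡ A (suc a) * A b + + 8 * (U (suc a) * U b)
    A-step = begin
      A (suc (a ℕ.+ b))                                          ≡⟨ A-suc (a ℕ.+ b) ⟩
      + 3 * A (a ℕ.+ b) + + 8 * U (a ℕ.+ b)                      ≡⟨ cong₂ (λ x y → + 3 * x + + 8 * y) (proj₂ ih) (proj₁ ih) ⟩
      + 3 * (A a * A b + + 8 * (U a * U b)) + + 8 * (A a * U b + U a * A b)
                                                                 ≡⟨ regroupA (A a) (A b) (U a) (U b) ⟩
      (+ 3 * A a + + 8 * U a) * A b + + 8 * ((A a + + 3 * U a) * U b)
                                                                 ≡⟨ cong₂ (λ x y → x * A b + + 8 * (y * U b)) (A-suc a) (U-suc a) ⟨
      A (suc a) * A b + + 8 * (U (suc a) * U b)                  ∎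
      where
      regroupA : ∀ a b c d → + 3 * (a * b + + 8 * (c * d)) + + 8 * (a * d + c * b)
                           ≡ (+ 3 * a + + 8 * c) * b + + 8 * ((a + + 3 * c) * d)
      regroupA = solve-∀

  U-+ : ∀ a b → U (a ℕ.+ b) ≡ A a * U b + U a * A b
  U-+ a b = proj₁ (+-formulas a b)

  A-+ : ∀ a b → A (a ℕ.+ b) ≡ A a * A b + + 8 * (U a * U b)
  A-+ a b = proj₂ (+-formulas a b)

  -- The Pell equation A² - 8 U² = 1 (the norm of (3 + 2√2)ⁿ).
  pell : ∀ n → A n * A n - + 8 * (U n * U n) ≡ + 1
  pell zero = refl
  pell (suc n) =
    trans (cong₂ (λ x y → x * x - + 8 * (y * y)) (A-suc n) (U-suc n))
      (trans (invariant (A n) (U n)) (pell n))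
    where
    invariant : ∀ a u → (+ 3 * a + + 8 * u) * (+ 3 * a + + 8 * u) - + 8 * ((a + + 3 * u) * (a + + 3 * u))
                      ≡ a * a - + 8 * (u * u)
    invariant = solve-∀

  U-∸ : ∀ a i → U (a ℕ.+ i) * A i - A (a ℕ.+ i) * U i ≡ U a
  U-∸ a i = begin
    U (a ℕ.+ i) * A i - A (a ℕ.+ i) * U i
      ≡⟨ cong₂ (λ x y → x * A i - y * U i) (U-+ a i) (A-+ a i) ⟩
    (A a * U i + U a * A i) * A i - (A a * A i + + 8 * (U a * U i)) * U i
      ≡⟨ identity (A a) (U a) (A i) (U i) ⟩
    U a * (A i * A i - + 8 * (U i * U i))
      ≡⟨ cong (U a *_) (pell i) ⟩
    U a * + 1
      ≡⟨ *-identityʳ (U a) ⟩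
    U a ∎
    where
    open ≡-Reasoning
    identity : ∀ x y z w → (x * w + y * z) * z - (x * z + + 8 * (y * w)) * w ≡ y * (z * z - + 8 * (w * w))
    identity = solve-∀

  reflection : ∀ {d} i j → d ∣ U (i ℕ.+ j) → d ∣ A (i ℕ.+ j) + + 1 → d ∣ U i - U j
  reflection {d} i j d∣U d∣A+1 =
    subst (d ∣_) (trans (identity (U (i ℕ.+ j)) (A j) (A (i ℕ.+ j)) (U j)) (cong (_- U j) (U-∸ i j)))
      (∣m∣n⇒∣m-n (∣m⇒∣m*n (A j) d∣U) (∣m⇒∣m*n (U j) d∣A+1))
    where
    identity : ∀ u a a′ u′ → u * a - (a′ + + 1) * u′ ≡ (u * a - a′ * u′) - u′
    identity = solve-∀

  ∣U-multiple : ∀ {d} k g → d ∣ U k → d ∣ U (g ℕ.* k)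
  ∣U-multiple k zero    _    = divides (+ 0) refl
  ∣U-multiple k (suc g) d∣Uk =
    subst (_ ∣_) (sym (U-+ k (g ℕ.* k)))
      (∣m∣n⇒∣m+n (∣n⇒∣m*n (A k) (∣U-multiple k g d∣Uk)) (∣m⇒∣m*n (A (g ℕ.* k)) d∣Uk))

  expansion : ∀ k g → ∃₂ λ X Y →
                (U (suc g ℕ.* k) ≡ + (suc g) * A k ^ g * U k + U k * U k * X)
              × (A (suc g ℕ.* k) ≡ A k ^ suc g + U k * U k * Y)
  expansion k zero =
    + 0 , + 0 ,
    subst (λ i → U i ≡ + 1 * + 1 * U k + U k * U k * + 0) (sym (ℕ.+-identityʳ k)) (baseU (U k)) ,
    subst (λ i → A i ≡ A k * + 1 + U k * U k * + 0) (sym (ℕ.+-identityʳ k)) (baseA (A k) (U k))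
    where
    baseU : ∀ u → u ≡ + 1 * + 1 * u + u * u * + 0
    baseU = solve-∀
    baseA : ∀ a u → a ≡ a * + 1 + u * u * + 0
    baseA = solve-∀
  expansion k (suc g) with expansion k g
  ... | X , Y , eqU , eqA =
    A k * X + U k * Y , A k * Y + + 8 * (+ 1 + + g) * A k ^ g + + 8 * U k * X ,
    trans (U-+ k (suc g ℕ.* k))
      (trans (cong₂ (λ x y → A k * x + U k * y) eqU eqA) (stepU (A k) (U k) (A k ^ g) (+ g) X Y)) ,
    trans (A-+ k (suc g ℕ.* k))
      (trans (cong₂ (λ x y → A k * y + + 8 * (U k * x)) eqU eqA) (stepA (A k) (U k) (A k ^ g) (+ g) X Y))
    where
    stepU : ∀ a u p G X Y → a * ((+ 1 + G) * p * u + u * u * X) + u * (a * p + u * u * Y)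
                          ≡ (+ 1 + (+ 1 + G)) * (a * p) * u + u * u * (a * X + u * Y)
    stepU = solve-∀
    stepA : ∀ a u p G X Y → a * (a * p + u * u * Y) + + 8 * (u * ((+ 1 + G) * p * u + u * u * X))
                          ≡ a * (a * p) + u * u * (a * Y + + 8 * (+ 1 + G) * p + + 8 * u * X)
    stepA = solve-∀

  lift : ∀ {d g} k → d ∣ U k → + g ∣ d → d * + g ∣ U (g ℕ.* k)
  lift {d} {zero}  k _    _   = divides (+ 0) refl
  lift {d} {suc g} k d∣Uk g∣d with expansion k g
  ... | X , _ , eqU , _ =
    subst (d * + suc g ∣_) (sym (trans eqU (regroup (+ suc g) (A k ^ g) (U k) X)))
      (∣m∣n⇒∣m+n (∣m⇒∣m*n (A k ^ g) (*-monoˡ-∣ (+ suc g) d∣Uk))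
                 (∣m⇒∣m*n X (∣-trans (*-monoʳ-∣ d (∣-trans g∣d d∣Uk)) (*-monoˡ-∣ (U k) d∣Uk))))
    where
    regroup : ∀ s p u X → s * p * u + u * u * X ≡ (u * s) * p + (u * u) * X
    regroup = solve-∀

  power-lift : ∀ {d} k → + d ∣ U k → ∀ j → + (d ℕ.^ suc j) ∣ U (d ℕ.^ j ℕ.* k)
  power-lift {d} k d∣Uk zero =
    subst₂ (λ a b → + a ∣ U b) (sym (ℕ.*-identityʳ d)) (sym (ℕ.+-identityʳ k)) d∣Uk
  power-lift {d} k d∣Uk (suc j) =
    subst₂ (λ a b → a ∣ U b) d^j+1*d≡d^j+2 (sym (ℕ.*-assoc d (d ℕ.^ j) k))
      (lift (d ℕ.^ j ℕ.* k) (power-lift k d∣Uk j) (∣ᵤ⇒∣ (ℕ.m∣m*n (d ℕ.^ j))))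
    where
    d^j+1*d≡d^j+2 : + (d ℕ.^ suc j) * + d ≡ + (d ℕ.^ suc (suc j))
    d^j+1*d≡d^j+2 = trans (sym (pos-* (d ℕ.^ suc j) d)) (cong +_ (ℕ.*-comm (d ℕ.^ suc j) d))

  2^a∣U[2^a] : ∀ a → + (2 ℕ.^ a) ∣ U (2 ℕ.^ a)
  2^a∣U[2^a] zero    = ∣-refl
  2^a∣U[2^a] (suc a) =
    subst (λ i → + (2 ℕ.^ suc a) ∣ U i) (ℕ.*-comm (2 ℕ.^ a) 2) (power-lift 2 (divides (+ 3) refl) a)

  A+1-oddMultiple : ∀ {d} k j → d ∣ U k → d ∣ A k + + 1 → d ∣ A (suc (2 ℕ.* j) ℕ.* k) + + 1
  A+1-oddMultiple {d} k j d∣Uk d∣Ak+1 with expansion k (2 ℕ.* j)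
  ... | _ , Y , _ , eqA =
    subst (d ∣_) (sym (trans (cong (_+ + 1) eqA) (regroup (A k ^ suc (2 ℕ.* j)) (U k) Y)))
      (∣m∣n⇒∣m+n (subst (λ v → d ∣ A k ^ suc (2 ℕ.* j) - v) ([-1]^odd j)
                     (^-cong-mod (A k) -[1+ 0 ] (suc (2 ℕ.* j)) d∣Ak+1))
                 (∣n⇒∣m*n (U k) (∣m⇒∣m*n Y d∣Uk)))
    where
    regroup : ∀ a u Y → (a + u * u * Y) + + 1 ≡ (a - -[1+ 0 ]) + u * (u * Y)
    regroup = solve-∀

  -- For an odd prime p, a prime power dividing U N also divides A N + 1 once p does:
  -- (A N + 1)(A N - 1) = 8 U N², and p cannot divide both factors.
  A+1-primePower : ∀ {p} → Prime p → ¬ (+ p ∣ + 2) → ∀ b N →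
                   + p ∣ A N + + 1 → + (p ℕ.^ b) ∣ U N → + (p ℕ.^ b) ∣ A N + + 1
  A+1-primePower {p} pp p∤2 b N p∣A+1 p^b∣U =
    primePower-cancelʳℤ pp p∤A-1 b (A N + + 1)
      (subst (+ (p ℕ.^ b) ∣_) (sym (factorPell (A N) (U N) (pell N)))
        (∣n⇒∣m*n (+ 8) (∣m⇒∣m*n (U N) p^b∣U)))
    where
    p∤A-1 : ¬ (+ p ∣ A N - + 1)
    p∤A-1 p∣A-1 = p∤2 (subst (+ p ∣_) (difference (A N)) (∣m∣n⇒∣m-n p∣A+1 p∣A-1))
      where
      difference : ∀ a → (a + + 1) - (a - + 1) ≡ + 2
      difference = solve-∀
    factorPell : ∀ a u → a * a - + 8 * (u * u) ≡ + 1 → (a + + 1) * (a - + 1) ≡ + 8 * (u * u)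
    factorPell a u a²-8u²≡1 = begin
      (a + + 1) * (a - + 1)                             ≡⟨ expand a u ⟩
      ((a * a - + 8 * (u * u)) - + 1) + + 8 * (u * u)   ≡⟨ cong (λ x → (x - + 1) + + 8 * (u * u)) a²-8u²≡1 ⟩
      (+ 1 - + 1) + + 8 * (u * u)                       ≡⟨ +-identityˡ (+ 8 * (u * u)) ⟩
      + 8 * (u * u)                                     ∎
      where
      open ≡-Reasoning
      expand : ∀ a u → (a + + 1) * (a - + 1) ≡ ((a * a - + 8 * (u * u)) - + 1) + + 8 * (u * u)
      expand = solve-∀

module TwoAdic where

  open import Data.Integer hiding (suc; pred)
  open import Data.Integer.Properties
  open import Data.Integer.Tactic.RingSolver using (solve-∀)
  open import Data.Integer.Divisibility.Signed
  import Data.Nat as ℕ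
  import Data.Nat.Properties as ℕ
  import Data.Nat.Divisibility as ℕ
  open import Data.Nat using (ℕ; zero; suc)
  open import Data.Nat.Primality using (prime[2])
  open import Data.Product using (∃; _,_)
  open import Data.Sum using (inj₁; inj₂)
  open import Data.Empty using (⊥-elim)
  open import Relation.Nullary using (¬_)
  open import Relation.Binary.PropositionalEquality
  open import Relation.Binary.Definitions using (tri<; tri≈; tri>)
  open IntegerDivisibility
  open Sequence
  open Parity using (halve)

  Odd : ℤ → Set
  Odd x = ∃ λ q → x ≡ + 2 * q + + 1

  odd⇒2∤ : ∀ {x} → Odd x → ¬ (+ 2 ∣ x)
  odd⇒2∤ {x} (q , x≡2q+1) 2∣x with ℕ.∣1⇒≡1 (∣⇒∣ᵤ (subst (+ 2 ∣_) (trans (cong (_- + 2 * q) x≡2q+1) (cancel q))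
                                               (∣m∣n⇒∣m-n 2∣x (∣m⇒∣m*n q ∣-refl))))
    where
    cancel : ∀ q → + 2 * q + + 1 - + 2 * q ≡ + 1
    cancel = solve-∀
  ... | ()

  A-odd : ∀ n → Odd (A n)
  A-odd zero    = + 0 , refl
  A-odd (suc n) with A-odd n
  ... | q , eq = + 3 * q + + 4 * U n + + 1 ,
                 trans (A-suc n) (trans (cong (λ a → + 3 * a + + 8 * U n) eq) (identity q (U n)))
    where
    identity : ∀ q u → + 3 * (+ 2 * q + + 1) + + 8 * u ≡ + 2 * (+ 3 * q + + 4 * u + + 1) + + 1
    identity = solve-∀

  oddDistance : ∀ j d → Odd (U (j ℕ.+ suc (d ℕ.+ d)) - U j)
  oddDistance j d with A-odd j | U-odd d | A-odd (suc (d ℕ.+ d))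
    where
    U-odd : ∀ d → Odd (U (suc (d ℕ.+ d)))
    U-odd d with A-odd (d ℕ.+ d)
    ... | q , eq = q + + 3 * (A d * U d) ,
      trans (U-suc (d ℕ.+ d)) (trans (cong₂ (λ x y → x + + 3 * y) eq (U-+ d d)) (identity q (A d) (U d)))
      where
      identity : ∀ q a u → (+ 2 * q + + 1) + + 3 * (a * u + u * a) ≡ + 2 * (q + + 3 * (a * u)) + + 1
      identity = solve-∀
  ... | a , eqA | u , eqU | c , eqC =
    + 2 * a * u + a + u + U j * c ,
    trans (cong (_- U j) (U-+ j (suc (d ℕ.+ d))))
      (trans (cong₃ eqA eqU eqC) (identity a u c (U j)))
    where
    cong₃ : ∀ {x y z x′ y′ z′} → x ≡ x′ → y ≡ y′ → z ≡ z′ → x * y + U j * z - U j ≡ x′ * y′ + U j * z′ - U j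
    cong₃ refl refl refl = refl
    identity : ∀ a u c j → (+ 2 * a + + 1) * (+ 2 * u + + 1) + j * (+ 2 * c + + 1) - j
                         ≡ + 2 * (+ 2 * a * u + a + u + j * c) + + 1
    identity = solve-∀

  evenDistance : ∀ j d → U (j ℕ.+ (d ℕ.+ d)) - U j ≡ + 2 * (U d * (A d * A j + + 8 * (U d * U j)))
  evenDistance j d = begin
    U (j ℕ.+ (d ℕ.+ d)) - U j
      ≡⟨ cong (_- U j) (U-+ j (d ℕ.+ d)) ⟩
    A j * U (d ℕ.+ d) + U j * A (d ℕ.+ d) - U j
      ≡⟨ cong₂ (λ x y → A j * x + U j * y - U j) (U-+ d d) (A-+ d d) ⟩
    A j * (A d * U d + U d * A d) + U j * (A d * A d + + 8 * (U d * U d)) - U j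
      ≡⟨ identity (A j) (U j) (A d) (U d) ⟩
    + 2 * (U d * c) + U j * ((A d * A d - + 8 * (U d * U d)) - + 1)
      ≡⟨ cong (λ x → + 2 * (U d * c) + U j * (x - + 1)) (pell d) ⟩
    + 2 * (U d * c) + U j * (+ 1 - + 1)
      ≡⟨ vanish (+ 2 * (U d * c)) (U j) ⟩
    + 2 * (U d * c) ∎
    where
    open ≡-Reasoning
    c : ℤ
    c = A d * A j + + 8 * (U d * U j)
    identity : ∀ aj uj ad ud → aj * (ad * ud + ud * ad) + uj * (ad * ad + + 8 * (ud * ud)) - uj
             ≡ + 2 * (ud * (ad * aj + + 8 * (ud * uj))) + uj * ((ad * ad - + 8 * (ud * ud)) - + 1)
    identity = solve-∀
    vanish : ∀ x y → x + y * (+ 1 - + 1) ≡ x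
    vanish = solve-∀

  oddCofactor : ∀ j d → Odd (A d * A j + + 8 * (U d * U j))
  oddCofactor j d with A-odd d | A-odd j
  ... | a , eqA | b , eqB = + 2 * a * b + a + b + + 4 * (U d * U j) ,
    trans (cong₂ (λ x y → x * y + + 8 * (U d * U j)) eqA eqB) (identity a b (U d) (U j))
    where
    identity : ∀ a b ud uj → (+ 2 * a + + 1) * (+ 2 * b + + 1) + + 8 * (ud * uj)
                           ≡ + 2 * (+ 2 * a * b + a + b + + 4 * (ud * uj)) + + 1
    identity = solve-∀

  2^k∣distance : ∀ k j t → + (2 ℕ.^ k) ∣ U (j ℕ.+ t) - U j → 2 ℕ.^ k ℕ.∣ t
  2^k∣distance zero j t _ = ℕ.1∣ t
  2^k∣distance (suc k) j t h with halve t
  ... | inj₂ (d , refl) = ⊥-elim (odd⇒2∤ (oddDistance j d) (∣-trans (∣ᵤ⇒∣ (ℕ.m∣m*n (2 ℕ.^ k))) h))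
  ... | inj₁ (d , refl) =
    subst (2 ℕ.* 2 ℕ.^ k ℕ.∣_) (double d) (ℕ.*-monoʳ-∣ 2 (2^k∣distance k 0 d 2^k∣U[0+d]-U0))
    where
    double : ∀ d → 2 ℕ.* d ≡ d ℕ.+ d
    double d = cong (d ℕ.+_) (ℕ.+-identityʳ d)
    2^k∣U[d]·odd : + (2 ℕ.^ k) ∣ U d * (A d * A j + + 8 * (U d * U j))
    2^k∣U[d]·odd = *-cancelˡ-∣ (+ 2) (subst₂ _∣_ (pos-* 2 (2 ℕ.^ k)) (evenDistance j d) h)
    2^k∣U[0+d]-U0 : + (2 ℕ.^ k) ∣ U d - + 0
    2^k∣U[0+d]-U0 = subst (+ (2 ℕ.^ k) ∣_) (sym (+-identityʳ (U d)))
                      (primePower-cancelʳℤ prime[2] (odd⇒2∤ (oddCofactor j d)) k (U d) 2^k∣U[d]·odd)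

  2^e-apart : ∀ {e} i j → i ℕ.< j → j ℕ.< 2 ℕ.^ e → ¬ (+ (2 ℕ.^ e) ∣ U j - U i)
  2^e-apart {e} i j i<j j<2^e 2^e∣Uj-Ui =
    ℕ.<⇒≱ (ℕ.≤-<-trans (ℕ.m∸n≤m j i) j<2^e) (ℕ.∣⇒≤ ⦃ ℕ.>-nonZero (ℕ.m<n⇒0<n∸m i<j) ⦄ 2^e∣j-i)
    where
    2^e∣j-i : 2 ℕ.^ e ℕ.∣ j ℕ.∸ i
    2^e∣j-i = 2^k∣distance e i (j ℕ.∸ i)
                (subst (λ k → + (2 ℕ.^ e) ∣ U k - U i) (sym (ℕ.m+[n∸m]≡n (ℕ.<⇒≤ i<j))) 2^e∣Uj-Ui)

  incongruent-mod-2^e : ∀ e n → n ℕ.≤ 2 ℕ.^ e → PairwiseIncongruent n (2 ℕ.^ e)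
  incongruent-mod-2^e e n n≤2^e i j i<n j<n i≢j Ui≡Uj with ℕ.<-cmp i j
  ... | tri< i<j _ _ = 2^e-apart {e} i j i<j (ℕ.<-≤-trans j<n n≤2^e)
                         (subst (+ (2 ℕ.^ e) ∣_) (neg-minus (U i) (U j)) (∣m⇒∣-m (∣ᵤ⇒∣ Ui≡Uj)))
    where
    neg-minus : ∀ x y → - (x - y) ≡ y - x
    neg-minus = solve-∀
  ... | tri≈ _ i≡j _ = i≢j i≡j
  ... | tri> _ _ j<i = 2^e-apart {e} j i j<i (ℕ.<-≤-trans i<n n≤2^e) (∣ᵤ⇒∣ Ui≡Uj)

module BinomialCoefficients where

  open import Data.Nat
  open import Data.Nat.Properties
  open import Data.Nat.Divisibility
  open import Data.Nat.DivMod using (m/n*n≡m)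
  open import Data.Nat.Primality using (Prime; euclidsLemma; ¬prime[1])
  open import Data.Nat.Combinatorics using (_C_; k![n∸k]!∣n!)
  open import Data.Nat.Combinatorics.Specification using (nCk≡n!/k![n-k]!)
  open import Data.Sum using (inj₁; inj₂)
  open import Data.Empty using (⊥-elim)
  open import Relation.Nullary using (¬_)
  open import Relation.Binary.PropositionalEquality

  prime∤factorial : ∀ {p} → Prime p → ∀ j → j < p → ¬ p ∣ j !
  prime∤factorial pp zero    _   p∣1 = ¬prime[1] (subst Prime (∣1⇒≡1 p∣1) pp)
  prime∤factorial pp (suc j) j<p p∣j! with euclidsLemma (suc j) (j !) pp p∣j!
  ... | inj₁ p∣j+1 = <⇒≱ j<p (∣⇒≤ p∣j+1)
  ... | inj₂ p∣j!′ = prime∤factorial pp j (<-trans (n<1+n j) j<p) p∣j!′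

  prime∣binomial : ∀ {p} → Prime p → ∀ k → 0 < k → k < p → p ∣ p C k
  prime∣binomial {p} pp k 0<k k<p with euclidsLemma (p C k) (k ! * (p ∸ k) !) pp p∣C*k!*[p-k]!
    where
    instance _ = k !* (p ∸ k) !≢0
    C*k!*[p-k]!≡p! : (p C k) * (k ! * (p ∸ k) !) ≡ p !
    C*k!*[p-k]!≡p! = trans (cong (_* (k ! * (p ∸ k) !)) (nCk≡n!/k![n-k]! (<⇒≤ k<p)))
                           (m/n*n≡m (k![n∸k]!∣n! (<⇒≤ k<p)))
    p∣p! : p ∣ p !
    p∣p! = n∣n! (<-trans 0<k k<p)
      where
      n∣n! : ∀ {n} → 0 < n → n ∣ n !
      n∣n! {suc n} _ = m∣m*n (n !)
    p∣C*k!*[p-k]! : p ∣ (p C k) * (k ! * (p ∸ k) !)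
    p∣C*k!*[p-k]! = subst (p ∣_) (sym C*k!*[p-k]!≡p!) p∣p!
  ... | inj₁ p∣C = p∣C
  ... | inj₂ p∣k!*[p-k]! with euclidsLemma (k !) ((p ∸ k) !) pp p∣k!*[p-k]!
  ...   | inj₁ p∣k! = ⊥-elim (prime∤factorial pp k k<p p∣k!)
  ...   | inj₂ p∣[p-k]! = ⊥-elim (prime∤factorial pp (p ∸ k) (∸-monoʳ-< 0<k (<⇒≤ k<p)) p∣[p-k]!)

module QuadraticRings where

  open import Data.Integer hiding (suc; pred)
  open import Data.Integer.Properties
  open import Data.Integer.Tactic.RingSolver using (solve-∀)
  open import Data.Integer.Divisibility.Signed
  import Data.Nat as ℕ
  import Data.Nat.Properties as ℕ
  import Data.Nat.Divisibility as ℕ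
  open import Data.Nat using (ℕ; zero; suc)
  open import Data.Nat.Primality using (Prime; prime)
  open import Data.Nat.Combinatorics using (_C_; nCn≡1)
  open import Data.Fin using (Fin; toℕ; fromℕ; inject₁) renaming (zero to fzero; suc to fsuc)
  open import Data.Fin.Properties using (toℕ-fromℕ; toℕ-inject₁; toℕ<n)
  open import Data.Product using (_×_; _,_; proj₁)
  open import Relation.Binary.PropositionalEquality
  open import Algebra.Bundles using (CommutativeSemiring)
  open import Level using (0ℓ)
  open IntegerDivisibility
  open BinomialCoefficients

  -- The ring ℤ[√D], with a + b√D represented by the pair (a , b).
  module Ring (D : ℤ) where

    Q : Set
    Q = ℤ × ℤ

    infixl 6 _⊕_
    infixl 7 _⊗_
    _⊕_ : Q → Q → Q
    (a , b) ⊕ (c , d) = a + c , b + d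
    _⊗_ : Q → Q → Q
    (a , b) ⊗ (c , d) = a * c + D * (b * d) , a * d + b * c
    0Q 1Q : Q
    0Q = + 0 , + 0
    1Q = + 1 , + 0

    module Laws where
      ⊗-assoc : ∀ x y z → (x ⊗ y) ⊗ z ≡ x ⊗ (y ⊗ z)
      ⊗-assoc (a , b) (c , d) (e , f) = cong₂ _,_ (re D a b c d e f) (im D a b c d e f)
        where
        re : ∀ D a b c d e f → (a * c + D * (b * d)) * e + D * ((a * d + b * c) * f)
                            ≡ a * (c * e + D * (d * f)) + D * (b * (c * f + d * e))
        re = solve-∀
        im : ∀ D a b c d e f → (a * c + D * (b * d)) * f + (a * d + b * c) * e
                            ≡ a * (c * f + d * e) + b * (c * e + D * (d * f))
        im = solve-∀
      ⊗-comm : ∀ x y → x ⊗ y ≡ y ⊗ x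
      ⊗-comm (a , b) (c , d) = cong₂ _,_ (re D a b c d) (im a b c d)
        where
        re : ∀ D a b c d → a * c + D * (b * d) ≡ c * a + D * (d * b)
        re = solve-∀
        im : ∀ a b c d → a * d + b * c ≡ c * b + d * a
        im = solve-∀
      ⊗-identityˡ : ∀ x → 1Q ⊗ x ≡ x
      ⊗-identityˡ (a , b) = cong₂ _,_ (re D a b) (im a b)
        where
        re : ∀ D a b → + 1 * a + D * (+ 0 * b) ≡ a
        re = solve-∀
        im : ∀ a b → + 1 * b + + 0 * a ≡ b
        im = solve-∀
      ⊕-assoc : ∀ x y z → (x ⊕ y) ⊕ z ≡ x ⊕ (y ⊕ z)
      ⊕-assoc (a , b) (c , d) (e , f) = cong₂ _,_ (+-assoc a c e) (+-assoc b d f)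
      ⊕-comm : ∀ x y → x ⊕ y ≡ y ⊕ x
      ⊕-comm (a , b) (c , d) = cong₂ _,_ (+-comm a c) (+-comm b d)
      ⊕-identityˡ : ∀ x → 0Q ⊕ x ≡ x
      ⊕-identityˡ (a , b) = cong₂ _,_ (+-identityˡ a) (+-identityˡ b)
      distribʳ : ∀ x y z → (y ⊕ z) ⊗ x ≡ (y ⊗ x) ⊕ (z ⊗ x)
      distribʳ (e , f) (a , b) (c , d) = cong₂ _,_ (re D a b c d e f) (im a b c d e f)
        where
        re : ∀ D a b c d e f → (a + c) * e + D * ((b + d) * f) ≡ (a * e + D * (b * f)) + (c * e + D * (d * f))
        re = solve-∀
        im : ∀ a b c d e f → (a + c) * f + (b + d) * e ≡ (a * f + b * e) + (c * f + d * e)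
        im = solve-∀
      zeroˡ : ∀ x → 0Q ⊗ x ≡ 0Q
      zeroˡ (a , b) = cong₂ _,_ (re D a b) (im a b)
        where
        re : ∀ D a b → + 0 * a + D * (+ 0 * b) ≡ + 0
        re = solve-∀
        im : ∀ a b → + 0 * b + + 0 * a ≡ + 0
        im = solve-∀

    open Laws public
    open import Algebra.Structures.Biased {A = Q} _≡_

    -- ℤ[√D] as a commutative semiring, so that the library's binomial theorem applies.
    commutativeSemiring : CommutativeSemiring 0ℓ 0ℓ
    commutativeSemiring = record
      { Carrier = Q ; _≈_ = _≡_ ; _+_ = _⊕_ ; _*_ = _⊗_ ; 0# = 0Q ; 1# = 1Q
      ; isCommutativeSemiring = isCommutativeSemiringˡ record
        { +-isCommutativeMonoid = isCommutativeMonoidˡ record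
          { isSemigroup = record
            { isMagma = record { isEquivalence = isEquivalence ; ∙-cong = cong₂ _⊕_ } ; assoc = ⊕-assoc }
          ; identityˡ = ⊕-identityˡ ; comm = ⊕-comm }
        ; *-isCommutativeMonoid = isCommutativeMonoidˡ record
          { isSemigroup = record
            { isMagma = record { isEquivalence = isEquivalence ; ∙-cong = cong₂ _⊗_ } ; assoc = ⊗-assoc }
          ; identityˡ = ⊗-identityˡ ; comm = ⊗-comm }
        ; distribʳ = distribʳ ; zeroˡ = zeroˡ } }

    open CommutativeSemiring commutativeSemiring using (semiring; +-monoid; +-rawMonoid)
    open import Algebra.Properties.Semiring.Exp semiring public using (^-assocʳ) renaming (_^_ to _^Q_)
    open import Algebra.Properties.CommutativeSemiring.Binomial commutativeSemiring using (theorem)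
    open import Algebra.Definitions.RawMonoid +-rawMonoid using (sum) renaming (_×_ to _·_)
    open import Algebra.Properties.Monoid.Sum +-monoid using (sum-init-last)

    infix 4 _≋_[mod_]
    _≋_[mod_] : Q → Q → ℕ → Set
    (a , b) ≋ (c , d) [mod p ] = (+ p ∣ a - c) × (+ p ∣ b - d)

    _∣Q_ : ℕ → Q → Set
    p ∣Q (a , b) = (+ p ∣ a) × (+ p ∣ b)

    ≋-refl : ∀ {p} x → x ≋ x [mod p ]
    ≋-refl (a , b) = subst (+ _ ∣_) (sym (+-inverseʳ a)) (divides (+ 0) refl)
                   , subst (+ _ ∣_) (sym (+-inverseʳ b)) (divides (+ 0) refl)

    ≋-reflexive : ∀ {p x y} → x ≡ y → x ≋ y [mod p ]
    ≋-reflexive {x = x} refl = ≋-refl x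

    ≋-trans : ∀ {p} x y z → x ≋ y [mod p ] → y ≋ z [mod p ] → x ≋ z [mod p ]
    ≋-trans (a , b) (c , d) (e , f) (h₁ , h₂) (h₃ , h₄) =
      subst (+ _ ∣_) (sym (telescope a c e)) (∣m∣n⇒∣m+n h₁ h₃) ,
      subst (+ _ ∣_) (sym (telescope b d f)) (∣m∣n⇒∣m+n h₂ h₄)
      where
      telescope : ∀ x y z → x - z ≡ (x - y) + (y - z)
      telescope = solve-∀

    ⊗-cong : ∀ {p} x x′ y y′ → x ≋ x′ [mod p ] → y ≋ y′ [mod p ] → x ⊗ y ≋ x′ ⊗ y′ [mod p ]
    ⊗-cong {p} (a , b) (a′ , b′) (c , d) (c′ , d′) (h₁ , h₂) (h₃ , h₄) =
      subst (+ p ∣_) (sym (re D a b c d a′ b′ c′ d′))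
        (∣m∣n⇒∣m+n (*-cong-mod a a′ c c′ h₁ h₃) (∣n⇒∣m*n D (*-cong-mod b b′ d d′ h₂ h₄))) ,
      subst (+ p ∣_) (sym (im a b c d a′ b′ c′ d′))
        (∣m∣n⇒∣m+n (*-cong-mod a a′ d d′ h₁ h₄) (*-cong-mod b b′ c c′ h₂ h₃))
      where
      re : ∀ D a b c d a′ b′ c′ d′ → (a * c + D * (b * d)) - (a′ * c′ + D * (b′ * d′))
                                   ≡ (a * c - a′ * c′) + D * (b * d - b′ * d′)
      re = solve-∀
      im : ∀ a b c d a′ b′ c′ d′ → (a * d + b * c) - (a′ * d′ + b′ * c′) ≡ (a * d - a′ * d′) + (b * c - b′ * c′)
      im = solve-∀

    ·-pair : ∀ n a b → n · (a , b) ≡ (+ n * a , + n * b)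
    ·-pair zero    a b = refl
    ·-pair (suc n) a b = trans (cong ((a , b) ⊕_) (·-pair n a b)) (cong₂ _,_ (unfold (+ n) a) (unfold (+ n) b))
      where
      unfold : ∀ n a → a + n * a ≡ (+ 1 + n) * a
      unfold = solve-∀

    ∣Q-· : ∀ {p} n a b → p ℕ.∣ n → p ∣Q (n · (a , b))
    ∣Q-· {p} n a b p∣n = subst (p ∣Q_) (sym (·-pair n a b)) (∣m⇒∣m*n {m = + n} a (∣ᵤ⇒∣ p∣n) , ∣m⇒∣m*n {m = + n} b (∣ᵤ⇒∣ p∣n))

    ∣Q-sum : ∀ {p n} (g : Fin n → Q) → (∀ i → p ∣Q g i) → p ∣Q sum g
    ∣Q-sum {n = zero}  g _   = divides (+ 0) refl , divides (+ 0) refl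
    ∣Q-sum {n = suc n} g p∣g with g fzero | p∣g fzero | ∣Q-sum (λ i → g (fsuc i)) (λ i → p∣g (fsuc i))
    ... | _ , _ | h₁ , h₂ | h₃ , h₄ = ∣m∣n⇒∣m+n h₁ h₃ , ∣m∣n⇒∣m+n h₂ h₄

    -- Frobenius: (x + y)ᵖ ≡ xᵖ + yᵖ modulo a prime p, via the binomial theorem
    -- and p ∣ p C k for 0 < k < p.
    frobenius : ∀ {p} → Prime p → ∀ x y → (x ⊕ y) ^Q p ≋ x ^Q p ⊕ y ^Q p [mod p ]
    frobenius {zero} (prime ⦃ () ⦄ _)
    frobenius {suc q} pp x y =
      subst (λ z → z ≋ x ^Q p ⊕ y ^Q p [mod p ]) (sym expansion)
        (subst₂ (λ a b → a ⊕ (middle ⊕ b) ≋ x ^Q p ⊕ y ^Q p [mod p ]) (sym first) (sym last)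
           (dropMiddle (y ^Q p) middle (x ^Q p) (∣Q-sum _ middle-divisible)))
      where
      p : ℕ
      p = suc q
      term : Fin (suc p) → Q
      term k = (p C toℕ k) · (x ^Q toℕ k ⊗ y ^Q (p ℕ.∸ toℕ k))
      middle : Q
      middle = sum (λ i → term (fsuc (inject₁ i)))
      expansion : (x ⊕ y) ^Q p ≡ term fzero ⊕ (middle ⊕ term (fsuc (fromℕ q)))
      expansion = trans (theorem p x y) (cong (term fzero ⊕_) (sum-init-last (λ i → term (fsuc i))))
      first : term fzero ≡ y ^Q p
      first = trans (⊕-identityʳ (1Q ⊗ y ^Q p)) (⊗-identityˡ (y ^Q p))
        where
        ⊕-identityʳ : ∀ z → z ⊕ 0Q ≡ z
        ⊕-identityʳ z = trans (⊕-comm z 0Q) (⊕-identityˡ z)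
      last : term (fsuc (fromℕ q)) ≡ x ^Q p
      last rewrite toℕ-fromℕ q | nCn≡1 p | ℕ.n∸n≡0 q =
        trans (⊕-comm (x ^Q p ⊗ 1Q) 0Q) (trans (⊕-identityˡ _) (trans (⊗-comm (x ^Q p) 1Q) (⊗-identityˡ (x ^Q p))))
      middle-divisible : ∀ i → p ∣Q term (fsuc (inject₁ i))
      middle-divisible i with x ^Q suc (toℕ (inject₁ i)) ⊗ y ^Q (p ℕ.∸ suc (toℕ (inject₁ i)))
      ... | a , b = ∣Q-· (p C suc (toℕ (inject₁ i))) a b
                      (prime∣binomial pp (suc (toℕ (inject₁ i))) (ℕ.s≤s ℕ.z≤n)
                        (ℕ.s≤s (subst (ℕ._< q) (sym (toℕ-inject₁ i)) (toℕ<n i))))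
      dropMiddle : ∀ Y M X → p ∣Q M → Y ⊕ (M ⊕ X) ≋ X ⊕ Y [mod p ]
      dropMiddle (y₁ , y₂) (m₁ , m₂) (x₁ , x₂) (h₁ , h₂) =
        subst (+ p ∣_) (sym (cancel y₁ m₁ x₁)) h₁ , subst (+ p ∣_) (sym (cancel y₂ m₂ x₂)) h₂
        where
        cancel : ∀ y m x → y + (m + x) - (x + y) ≡ m
        cancel = solve-∀

    rational-^ : ∀ a n → (a , + 0) ^Q n ≡ (a ^ n , + 0)
    rational-^ a zero    = refl
    rational-^ a (suc n) =
      trans (cong ((a , + 0) ⊗_) (rational-^ a n)) (cong₂ _,_ (re D a (a ^ n)) (im a (a ^ n)))
      where
      re : ∀ D a c → a * c + D * (+ 0 * + 0) ≡ a * c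
      re = solve-∀
      im : ∀ a c → a * + 0 + + 0 * c ≡ + 0
      im = solve-∀

    pure-^-even : ∀ b h → (+ 0 , b) ^Q (2 ℕ.* h) ≡ ((b * b * D) ^ h , + 0)
    pure-^-even b h =
      trans (sym (^-assocʳ (+ 0 , b) 2 h)) (trans (cong (_^Q h) square) (rational-^ (b * b * D) h))
      where
      square : (+ 0 , b) ^Q 2 ≡ (b * b * D , + 0)
      square = cong₂ _,_ (re D b) (im D b)
        where
        re : ∀ D b → + 0 * (+ 0 * + 1 + D * (b * + 0)) + D * (b * (+ 0 * + 0 + b * + 1)) ≡ b * b * D
        re = solve-∀
        im : ∀ D b → + 0 * (+ 0 * + 0 + b * + 1) + b * (+ 0 * + 1 + D * (b * + 0)) ≡ + 0
        im = solve-∀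

    pure-^-odd : ∀ b h → (+ 0 , b) ^Q suc (2 ℕ.* h) ≡ (+ 0 , b * (b * b * D) ^ h)
    pure-^-odd b h =
      trans (cong ((+ 0 , b) ⊗_) (pure-^-even b h)) (cong₂ _,_ (re D b ((b * b * D) ^ h)) (im b ((b * b * D) ^ h)))
      where
      re : ∀ D b c → + 0 * c + D * (b * + 0) ≡ + 0
      re = solve-∀
      im : ∀ b c → + 0 * + 0 + b * c ≡ b * c
      im = solve-∀

    frobenius-1+√D : ∀ h → Prime (suc (2 ℕ.* h)) → (+ 1 , + 1) ^Q suc (2 ℕ.* h) ≋ (+ 1 , D ^ h) [mod suc (2 ℕ.* h) ]
    frobenius-1+√D h pp =
      ≋-trans ((+ 1 , + 1) ^Q p) _ (+ 1 , D ^ h) (frobenius pp (+ 1 , + 0) (+ 0 , + 1))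
        (≋-reflexive (trans (cong₂ _⊕_ (trans (rational-^ (+ 1) p) (cong (_, + 0) (^-zeroˡ p)))
                                       (trans (pure-^-odd (+ 1) h) (cong (+ 0 ,_) (unit D h))))
                            (cong (+ 1 ,_) (+-identityˡ (D ^ h)))))
      where
      p : ℕ
      p = suc (2 ℕ.* h)
      unit : ∀ D h → + 1 * (+ 1 * + 1 * D) ^ h ≡ D ^ h
      unit D h = trans (*-identityˡ _) (cong (_^ h) (*-identityˡ D))

    norm : Q → ℤ
    norm (a , b) = a * a - D * (b * b)

    norm-⊗ : ∀ x y → norm (x ⊗ y) ≡ norm x * norm y
    norm-⊗ (a , b) (c , d) = identity D a b c d
      where
      identity : ∀ D a b c d → (a * c + D * (b * d)) * (a * c + D * (b * d)) - D * ((a * d + b * c) * (a * d + b * c))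
                             ≡ (a * a - D * (b * b)) * (c * c - D * (d * d))
      identity = solve-∀

    norm-^ : ∀ x n → norm (x ^Q n) ≡ norm x ^ n
    norm-^ x zero    = identity D
      where
      identity : ∀ D → + 1 * + 1 - D * (+ 0 * + 0) ≡ + 1
      identity = solve-∀
    norm-^ x (suc n) = trans (norm-⊗ x (x ^Q n)) (cong (norm x *_) (norm-^ x n))

    norm-cong : ∀ {p} x y → x ≋ y [mod p ] → + p ∣ norm x - norm y
    norm-cong {p} (a , b) (a′ , b′) (h₁ , h₂) =
      subst (+ p ∣_) (sym (regroup D a b a′ b′))
        (∣m∣n⇒∣m-n (*-cong-mod a a′ a a′ h₁ h₁) (∣n⇒∣m*n D (*-cong-mod b b′ b b′ h₂ h₂)))
      where
      regroup : ∀ D a b a′ b′ → (a * a - D * (b * b)) - (a′ * a′ - D * (b′ * b′))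
                              ≡ (a * a - a′ * a′) - D * (b * b - b′ * b′)
      regroup = solve-∀

  -- Fermat's little theorem, from Frobenius on rational elements: aᵖ ≡ a modulo p.
  fermat : ∀ {p} → Prime p → ∀ a → + p ∣ (+ a) ^ p - + a
  fermat {zero}  (prime ⦃ () ⦄ _)
  fermat {suc _} pp zero = divides (+ 0) refl
  fermat {p} pp (suc a) =
    subst (+ p ∣_) (telescope ((+ suc a) ^ p) ((+ a) ^ p) (+ a)) (∣m∣n⇒∣m+n (proj₁ step) (fermat pp a))
    where
    open Ring (+ 0)
    telescope : ∀ S w x → S - (+ 1 + w) + (w - x) ≡ S - (+ 1 + x)
    telescope = solve-∀
    step : ((+ suc a) ^ p , + 0) ≋ (+ 1 + (+ a) ^ p , + 0 + + 0) [mod p ]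
    step = subst₂ (λ u v → u ≋ v [mod p ])
             (rational-^ (+ suc a) p)
             (cong₂ _⊕_ (trans (rational-^ (+ 1) p) (cong (_, + 0) (^-zeroˡ p))) (rational-^ (+ a) p))
             (frobenius pp (+ 1 , + 0) (+ a , + 0))

module OddPrimes where

  open import Data.Integer hiding (suc; pred)
  open import Data.Integer.Properties
  open import Data.Integer.Tactic.RingSolver using (solve-∀)
  open import Data.Integer.Divisibility.Signed
  import Data.Nat as ℕ
  import Data.Nat.Properties as ℕ
  import Data.Nat.Divisibility as ℕ
  open import Data.Nat using (ℕ; zero; suc)
  import Data.Nat.Tactic.RingSolver as NatSolver
  open import Data.Nat.Primality using (Prime)
  open import Data.Product using (_×_; _,_; proj₁; proj₂)
  open import Data.Sum using (_⊎_; inj₁; inj₂)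
  open import Data.Empty using (⊥-elim)
  open import Relation.Nullary using (¬_)
  open import Relation.Binary.PropositionalEquality
  open IntegerDivisibility
  open Sequence
  open QuadraticRings

  module AtOddPrime (h : ℕ) (pp : Prime (suc (2 ℕ.* h))) (1≤h : 1 ℕ.≤ h) where

    p : ℕ
    p = suc (2 ℕ.* h)

    p∤2 : ¬ (+ p ∣ + 2)
    p∤2 p∣2 = ℕ.<⇒≱ (ℕ.s≤s (ℕ.+-mono-≤ 1≤h (ℕ.≤-trans 1≤h (ℕ.m≤m+n h 0)))) (ℕ.∣⇒≤ (∣⇒∣ᵤ p∣2))

    cancel-2 : ∀ x → + p ∣ + 2 * x → + p ∣ x
    cancel-2 x p∣2x with euclidsLemmaℤ (+ 2) x pp p∣2x
    ... | inj₁ p∣2 = ⊥-elim (p∤2 p∣2)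
    ... | inj₂ p∣x = p∣x

    ε : ℤ
    ε = (+ 2) ^ h

    -- Arithmetic in ℤ[√2]: z = 1 + √2 has norm -1 and z² = α = 3 + 2√2,
    -- whose powers are αⁿ = A n + 2 U n √2.
    open Ring (+ 2)

    z α z̄ : Q
    z = + 1 , + 1
    α = + 3 , + 2
    z̄ = + 1 , -[1+ 0 ]

    α^ : ∀ n → α ^Q n ≡ (A n , + 2 * U n)
    α^ zero    = refl
    α^ (suc n) = trans (cong (α ⊗_) (α^ n))
      (cong₂ _,_ (trans (re (A n) (U n)) (sym (A-suc n))) (trans (im (A n) (U n)) (cong (+ 2 *_) (sym (U-suc n)))))
      where
      re : ∀ a u → + 3 * a + + 2 * (+ 2 * (+ 2 * u)) ≡ + 3 * a + + 8 * u
      re = solve-∀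
      im : ∀ a u → + 3 * (+ 2 * u) + + 2 * a ≡ + 2 * (a + + 3 * u)
      im = solve-∀

    z^p : z ^Q p ≡ z ⊗ α ^Q h
    z^p = cong (z ⊗_) (sym (^-assocʳ z 2 h))

    -- Taking norms in zᵖ ≡ 1 + ε√2 gives -1 ≡ 1 - 2ε², so ε ≡ ±1 (mod p).
    ε≡±1 : (+ p ∣ ε - + 1) ⊎ (+ p ∣ ε + + 1)
    ε≡±1 = euclidsLemmaℤ (ε - + 1) (ε + + 1) pp (cancel-2 _ (subst (+ p ∣_) (factor ε) p∣N[z^p]-N[1+ε√2]))
      where
      factor : ∀ e → -[1+ 0 ] - (+ 1 * + 1 - + 2 * (e * e)) ≡ + 2 * ((e - + 1) * (e + + 1))
      factor = solve-∀
      p∣N[z^p]-N[1+ε√2] : + p ∣ -[1+ 0 ] - norm (+ 1 , ε)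
      p∣N[z^p]-N[1+ε√2] = subst (λ v → + p ∣ v - norm (+ 1 , ε)) (trans (norm-^ z p) ([-1]^odd h))
                            (norm-cong (z ^Q p) (+ 1 , ε) (frobenius-1+√D h pp))

    -- If ε ≡ 1 then zᵖ ≡ z, so αʰ ≡ 1 and p ∣ U h.
    ε≡1⇒p∣U[h] : + p ∣ ε - + 1 → + p ∣ U h
    ε≡1⇒p∣U[h] p∣ε-1 =
      cancel-2 (U h) (subst (+ p ∣_) (neg-involutive (+ 2 * U h))
        (∣m⇒∣-m (subst (+ p ∣_) (imaginary (A h) (U h)) (proj₂ z̄zα^h≡z̄z))))
      where
      imaginary : ∀ a u → (-[1+ 0 ] * (+ 2 * u) + + 0 * a) - + 0 ≡ - (+ 2 * u)
      imaginary = solve-∀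
      zα^h≡z : z ⊗ α ^Q h ≋ z [mod p ]
      zα^h≡z = ≋-trans (z ⊗ α ^Q h) (+ 1 , ε) z (subst (λ v → v ≋ (+ 1 , ε) [mod p ]) z^p (frobenius-1+√D h pp))
                 (divides (+ 0) refl , p∣ε-1)
      z̄zα^h≡z̄z : (-[1+ 0 ] , + 0) ⊗ (A h , + 2 * U h) ≋ (-[1+ 0 ] , + 0) [mod p ]
      z̄zα^h≡z̄z = subst (λ v → v ≋ (-[1+ 0 ] , + 0) [mod p ])
                   (trans (sym (⊗-assoc z̄ z (α ^Q h))) (cong (z̄ ⊗ z ⊗_) (α^ h)))
                   (⊗-cong z̄ z̄ (z ⊗ α ^Q h) z (≋-refl z̄) zα^h≡z)

    -- If ε ≡ -1 then zᵖ ≡ z̄, so αʰ⁺¹ = z zᵖ ≡ z z̄ = -1: p ∣ U (h+1) and p ∣ A (h+1) + 1.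
    ε≡-1⇒α^[h+1]≡-1 : + p ∣ ε + + 1 → (+ p ∣ U (suc h)) × (+ p ∣ A (suc h) + + 1)
    ε≡-1⇒α^[h+1]≡-1 p∣ε+1 = cancel-2 (U (suc h)) (subst (+ p ∣_) (+-identityʳ _) (proj₂ α^[h+1]≡-1)) , proj₁ α^[h+1]≡-1
      where
      z^p≡z̄ : z ^Q p ≋ z̄ [mod p ]
      z^p≡z̄ = ≋-trans (z ^Q p) (+ 1 , ε) z̄ (frobenius-1+√D h pp) (divides (+ 0) refl , p∣ε+1)
      z⊗z^p≡α^[h+1] : z ⊗ z ^Q p ≡ (A (suc h) , + 2 * U (suc h))
      z⊗z^p≡α^[h+1] = trans (cong (z ⊗_) z^p) (trans (sym (⊗-assoc z z (α ^Q h))) (α^ (suc h)))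
      α^[h+1]≡-1 : (A (suc h) , + 2 * U (suc h)) ≋ (-[1+ 0 ] , + 0) [mod p ]
      α^[h+1]≡-1 = subst (λ v → v ≋ (-[1+ 0 ] , + 0) [mod p ]) z⊗z^p≡α^[h+1]
                     (⊗-cong z z (z ^Q p) z̄ (≋-refl z) z^p≡z̄)

    -- Euler's criterion (one direction): if 2 is a square modulo p then ε ≡ 1.
    -- With a = ∣x∣, Fermat gives p ∣ a (a²ʰ - 1), and p ∤ a since a² ≡ 2.
    square⇒ε≡1 : ∀ x → + p ∣ x * x - + 2 → + p ∣ ε - + 1
    square⇒ε≡1 x p∣x²-2 = conclude (euclidsLemmaℤ a (a² ^ h - + 1) pp p∣a[a²ʰ-1])
      where
      a a² : ℤ
      a = + ∣ x ∣
      a² = a * a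
      square-abs : ∀ x → x * x ≡ + ∣ x ∣ * + ∣ x ∣
      square-abs (+ _)    = refl
      square-abs -[1+ _ ] = refl
      p∣a²-2 : + p ∣ a² - + 2
      p∣a²-2 = subst (λ v → + p ∣ v - + 2) (square-abs x) p∣x²-2
      p∣a[a²ʰ-1] : + p ∣ a * (a² ^ h - + 1)
      p∣a[a²ʰ-1] = subst (+ p ∣_) (factor a (a² ^ h)) (subst (λ v → + p ∣ a * v - a) (^-double a h) (fermat pp ∣ x ∣))
        where
        factor : ∀ a s → a * s - a ≡ a * (s - + 1)
        factor = solve-∀
      conclude : (+ p ∣ a) ⊎ (+ p ∣ a² ^ h - + 1) → + p ∣ ε - + 1
      conclude (inj₁ p∣a) = ⊥-elim (p∤2 (subst (+ p ∣_) (difference a²) (∣m∣n⇒∣m-n (∣m⇒∣m*n a p∣a) p∣a²-2)))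
        where
        difference : ∀ s → s - (s - + 2) ≡ + 2
        difference = solve-∀
      conclude (inj₂ p∣a²ʰ-1) =
        subst (+ p ∣_) (difference (a² ^ h) ε) (∣m∣n⇒∣m-n p∣a²ʰ-1 (^-cong-mod a² (+ 2) h p∣a²-2))
        where
        difference : ∀ s e → (s - + 1) - (s - e) ≡ e - + 1
        difference = solve-∀

  -- Gaussian-integer argument: for p = 2h + 1 ≡ ±1 (mod 8) one has 2ʰ ≡ 1 (mod p).
  -- In ℤ[i], w = 1 + i has w² = 2i, and Frobenius gives wᵖ ≡ 1 + (-1)ʰ i.
  module Gaussian where

    open Ring -[1+ 0 ]

    w : Q
    w = + 1 , + 1

    w^[4k] : ∀ k → w ^Q (2 ℕ.* (2 ℕ.* k)) ≡ (-[1+ 3 ] ^ k , + 0)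
    w^[4k] k = trans (sym (^-assocʳ w 2 (2 ℕ.* k))) (pure-^-even (+ 2) k)

    -- p = 8t + 1: wᵖ = w · 16ᵗ and wᵖ ≡ w, so 2⁴ᵗ = 16ᵗ ≡ 1.
    2^h≡1-if-p≡1[mod8] : ∀ t → Prime (suc (2 ℕ.* (4 ℕ.* t))) → + suc (2 ℕ.* (4 ℕ.* t)) ∣ (+ 2) ^ (4 ℕ.* t) - + 1
    2^h≡1-if-p≡1[mod8] t pp = subst (+ p ∣_) (cong (_- + 1) 16ᵗ≡2^h) (subst (+ p ∣_) (real 16ᵗ) (proj₁ w16ᵗ≡w))
      where
      h : ℕ
      h = 4 ℕ.* t
      p : ℕ
      p = suc (2 ℕ.* h)
      4t≡2[2t] : h ≡ 2 ℕ.* (2 ℕ.* t)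
      4t≡2[2t] = ℕ.*-assoc 2 2 t
      16ᵗ : ℤ
      16ᵗ = (+ 16) ^ t
      16ᵗ≡2^h : 16ᵗ ≡ (+ 2) ^ h
      16ᵗ≡2^h = ^-*-assoc (+ 2) 4 t
      w^p≡w16ᵗ : w ^Q p ≡ w ⊗ (16ᵗ , + 0)
      w^p≡w16ᵗ = cong (w ⊗_) (trans (cong (λ k → w ^Q (2 ℕ.* k)) 4t≡2[2t])
                   (trans (w^[4k] (2 ℕ.* t)) (cong (_, + 0) (^-double -[1+ 3 ] t))))
      [-1]^h≡1 : -[1+ 0 ] ^ h ≡ + 1
      [-1]^h≡1 = trans (cong (-[1+ 0 ] ^_) 4t≡2[2t]) (trans (^-double -[1+ 0 ] (2 ℕ.* t)) (^-zeroˡ (2 ℕ.* t)))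
      w16ᵗ≡w : w ⊗ (16ᵗ , + 0) ≋ w [mod p ]
      w16ᵗ≡w = subst₂ (λ u v → u ≋ v [mod p ]) w^p≡w16ᵗ (cong (+ 1 ,_) [-1]^h≡1) (frobenius-1+√D h pp)
      real : ∀ E → (+ 1 * E + -[1+ 0 ] * (+ 1 * + 0)) - + 1 ≡ E - + 1
      real = solve-∀

    -- p = 8t + 7: wᵖ ≡ w̄, so w wᵖ = 16ᵗ⁺¹ ≡ w w̄ = 2, i.e. 2 (2⁴ᵗ⁺³ - 1) ≡ 0.
    2^h≡1-if-p≡7[mod8] : ∀ t → Prime (suc (2 ℕ.* (4 ℕ.* t ℕ.+ 3))) →
                          + suc (2 ℕ.* (4 ℕ.* t ℕ.+ 3)) ∣ (+ 2) ^ (4 ℕ.* t ℕ.+ 3) - + 1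
    2^h≡1-if-p≡7[mod8] t pp =
      AtOddPrime.cancel-2 h pp 1≤h _ (subst (+ p ∣_) factor 16ᵗ⁺¹≡2)
      where
      h : ℕ
      h = 4 ℕ.* t ℕ.+ 3
      p : ℕ
      p = suc (2 ℕ.* h)
      1≤h : 1 ℕ.≤ h
      1≤h = ℕ.≤-trans (ℕ.s≤s ℕ.z≤n) (ℕ.m≤n+m 3 (4 ℕ.* t))
      p+1≡8[t+1] : suc p ≡ 2 ℕ.* (2 ℕ.* (2 ℕ.* suc t))
      p+1≡8[t+1] = identity t
        where
        identity : ∀ t → suc (suc (2 ℕ.* (4 ℕ.* t ℕ.+ 3))) ≡ 2 ℕ.* (2 ℕ.* (2 ℕ.* suc t))
        identity = NatSolver.solve-∀
      [-1]^h≡-1 : -[1+ 0 ] ^ h ≡ -[1+ 0 ]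
      [-1]^h≡-1 = trans (cong (-[1+ 0 ] ^_) (h≡odd t)) ([-1]^odd (2 ℕ.* t ℕ.+ 1))
        where
        h≡odd : ∀ t → 4 ℕ.* t ℕ.+ 3 ≡ suc (2 ℕ.* (2 ℕ.* t ℕ.+ 1))
        h≡odd = NatSolver.solve-∀
      ww^p≡16ᵗ⁺¹ : w ⊗ w ^Q p ≡ ((+ 16) ^ suc t , + 0)
      ww^p≡16ᵗ⁺¹ = trans (cong (w ^Q_) p+1≡8[t+1])
                     (trans (w^[4k] (2 ℕ.* suc t)) (cong (_, + 0) (^-double -[1+ 3 ] (suc t))))
      ww^p≡2 : w ⊗ w ^Q p ≋ (+ 2 , + 0) [mod p ]
      ww^p≡2 = ⊗-cong w w (w ^Q p) (+ 1 , -[1+ 0 ]) (≋-refl w)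
                 (subst (λ v → w ^Q p ≋ (+ 1 , v) [mod p ]) [-1]^h≡-1 (frobenius-1+√D h pp))
      16ᵗ⁺¹≡2 : + p ∣ (+ 16) ^ suc t - + 2
      16ᵗ⁺¹≡2 = proj₁ (subst (λ v → v ≋ (+ 2 , + 0) [mod p ]) ww^p≡16ᵗ⁺¹ ww^p≡2)
      factor : (+ 16) ^ suc t - + 2 ≡ + 2 * ((+ 2) ^ h - + 1)
      factor = trans (regroup ((+ 16) ^ t))
                 (cong (λ v → + 2 * (v - + 1)) (sym (trans (^-distribˡ-+-* (+ 2) (4 ℕ.* t) 3)
                                                           (cong (_* + 8) (sym (^-*-assoc (+ 2) 4 t))))))
        where
        regroup : ∀ s → + 16 * s - + 2 ≡ + 2 * (s * + 8 - + 1)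
        regroup = solve-∀

module Zeros where

  open import Data.Nat
  open import Data.Nat.Properties
  open import Data.Nat.Divisibility
  open import Data.Nat.Primality
  open import Data.Nat.Induction using (<-rec)
  import Data.Integer as ℤ
  open import Data.Integer using (+_)
  open import Data.Integer.Properties using (pos-*)
  open import Data.Integer.Divisibility.Signed using (∣ᵤ⇒∣) renaming (_∣_ to _∣ℤ_; divides to dividesℤ)
  open import Data.Product
  open import Data.Sum
  open import Relation.Nullary
  open import Relation.Binary.PropositionalEquality
  open PrimePowers
  open IntegerDivisibility
  open Sequence
  open Parity
  open OddPrimes

  oddPrime-zero : ∀ h → Prime (suc (2 * h)) → 1 ≤ h → ∃ λ k → 1 ≤ k × k ≤ suc h × + suc (2 * h) ∣ℤ U k
  oddPrime-zero h pp 1≤h = [ good , bad ]′ (AtOddPrime.ε≡±1 h pp 1≤h)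
    where
    open AtOddPrime h pp 1≤h
    good : + p ∣ℤ ε ℤ.- + 1 → ∃ λ k → 1 ≤ k × k ≤ suc h × + suc (2 * h) ∣ℤ U k
    good p∣ε-1 = h , 1≤h , n≤1+n h , ε≡1⇒p∣U[h] p∣ε-1
    bad : + p ∣ℤ ε ℤ.+ + 1 → ∃ λ k → 1 ≤ k × k ≤ suc h × + suc (2 * h) ∣ℤ U k
    bad p∣ε+1 = suc h , s≤s z≤n , ≤-refl , proj₁ (ε≡-1⇒α^[h+1]≡-1 p∣ε+1)

  prime-zero : ∀ {p} → Prime p → ∃ λ k → 1 ≤ k × k ≤ p × + p ∣ℤ U k
  prime-zero pp with prime-2-or-odd pp
  ... | inj₁ refl = 2 , s≤s z≤n , ≤-refl , dividesℤ (+ 3) refl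
  ... | inj₂ (h , refl , 1≤h) = weaken (oddPrime-zero h pp 1≤h)
    where
    weaken : (∃ λ k → 1 ≤ k × k ≤ suc h × + suc (2 * h) ∣ℤ U k) →
             ∃ λ k → 1 ≤ k × k ≤ suc (2 * h) × + suc (2 * h) ∣ℤ U k
    weaken (k , 1≤k , k≤h+1 , p∣Uk) = k , 1≤k , ≤-trans k≤h+1 (s≤s (m≤m+n h _)) , p∣Uk

  -- Every t ≥ 1 divides some U K with 1 ≤ K ≤ t: peel off a prime p of t = q p;
  -- if p ∣ q lift a zero of q, otherwise multiply zeros of q and of p.
  zero-below : ∀ t → 1 ≤ t → ∃ λ K → 1 ≤ K × K ≤ t × + t ∣ℤ U K
  zero-below = <-rec (λ t → 1 ≤ t → ∃ λ K → 1 ≤ K × K ≤ t × + t ∣ℤ U K) step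
    where
    step : ∀ t → (∀ {t′} → t′ < t → 1 ≤ t′ → ∃ λ K → 1 ≤ K × K ≤ t′ × + t′ ∣ℤ U K) →
           1 ≤ t → ∃ λ K → 1 ≤ K × K ≤ t × + t ∣ℤ U K
    step t rec 1≤t with 1 <? t
    ... | no 1≮t rewrite ≤-antisym (≮⇒≥ 1≮t) 1≤t = 1 , ≤-refl , ≤-refl , ∣ᵤ⇒∣ (1∣ _)
    ... | yes 1<t with primeDivisor t 1<t
    ... | p , pp , divides q t≡qp
      with cofactor-< {q = q} 1≤t t≡qp (nonTrivial⇒n>1 p ⦃ prime⇒nonTrivial pp ⦄)
    ... | 1≤q , q<t with rec q<t 1≤q | p ∣? q
    ... | K , 1≤K , K≤q , q∣UK | yes p∣q =
      p * K , *-mono-≤ (<⇒≤ (nonTrivial⇒n>1 p ⦃ prime⇒nonTrivial pp ⦄)) 1≤K ,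
      ≤-trans (*-monoʳ-≤ p K≤q) (≤-reflexive (trans (*-comm p q) (sym t≡qp))) ,
      subst (_∣ℤ U (p * K)) (trans (sym (pos-* q p)) (cong +_ (sym t≡qp))) (lift K q∣UK (∣ᵤ⇒∣ p∣q))
    ... | K , 1≤K , K≤q , q∣UK | no p∤q with prime-zero pp
    ...   | k , 1≤k , k≤p , p∣Uk =
      K * k , *-mono-≤ 1≤K 1≤k , ≤-trans (*-mono-≤ K≤q k≤p) (≤-reflexive (sym t≡qp)) ,
      subst (λ v → + v ∣ℤ U (K * k)) (trans (cong (_* q) (*-identityʳ p)) (trans (*-comm p q) (sym t≡qp)))
        (primePower-∣-productℤ pp p∤q 1
          (subst (λ v → + v ∣ℤ U (K * k)) (sym (*-identityʳ p)) (∣U-multiple k K p∣Uk))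
          (subst (λ v → + q ∣ℤ U v) (*-comm k K) (∣U-multiple K k q∣UK)))

  -- Zeros k of a prime p and K of t, with p ∤ t, give the zero K pᵇ k of pᵇ⁺¹ t
  -- (lift k to pᵇ k, then combine the coprime factors).
  zero-of-product : ∀ {p t} → Prime p → ¬ p ∣ t → ∀ b k K → + p ∣ℤ U k → + t ∣ℤ U K →
                    + (p ^ suc b * t) ∣ℤ U (K * (p ^ b * k))
  zero-of-product {p} {t} pp p∤t b k K p∣Uk t∣UK =
    primePower-∣-productℤ pp p∤t (suc b)
      (∣U-multiple (p ^ b * k) K (power-lift k p∣Uk b))
      (subst (λ v → + t ∣ℤ U v) (*-comm (p ^ b * k) K) (∣U-multiple K (p ^ b * k) t∣UK))

module MinimalModulus where

  open import Data.Nat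
  open import Data.Nat.Properties
  open import Data.Nat.Divisibility
  open import Data.Nat.DivMod using (m*n/n≡m; [m+kn]%n≡m%n)
  open import Data.Nat.Primality
  import Data.Nat.Tactic.RingSolver as NatSolver
  import Data.Integer as ℤ
  open import Data.Integer using (+_; -[1+_])
  import Data.Integer.Properties as ℤ
  open import Data.Integer.Divisibility.Signed using (∣ᵤ⇒∣; ∣⇒∣ᵤ; ∣m⇒∣-m) renaming (_∣_ to _∣ℤ_)
  open import Data.Product
  open import Data.Sum
  open import Data.Empty
  open import Relation.Nullary
  open import Relation.Binary.PropositionalEquality
  open PrimePowers
  open IntegerDivisibility
  open Sequence
  open TwoAdic using (incongruent-mod-2^e)
  open Parity
  open OddPrimes
  open Zeros

  module _ (j m : ℕ) (1≤j : 1 ≤ j) (isD₁ : IsD₁ (suc j) m) where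

    private
      n : ℕ
      n = suc j

      1≤m : 1 ≤ m
      1≤m = proj₁ isD₁

      incongruent : PairwiseIncongruent n m
      incongruent = proj₁ (proj₂ isD₁)

      minimal : ∀ m′ → 1 ≤ m′ → PairwiseIncongruent n m′ → m ≤ m′
      minimal = proj₂ (proj₂ isD₁)

    -- Comparing with the incongruent modulus 2ᵉ⁺¹, where 2ᵉ ≤ j < 2ᵉ⁺¹: m ≤ 2 j.
    m≤2j : m ≤ 2 * j
    m≤2j with power-of-two-bracket j 1≤j
    ... | e , 2^e≤j , j<2^e+1 =
      ≤-trans (minimal (2 ^ suc e) (m^n>0 2 (suc e)) (incongruent-mod-2^e (suc e) n j<2^e+1))
              (*-monoʳ-≤ 2 2^e≤j)

    -- A zero of U modulo m at a positive index N forces N ≥ n, since otherwise U 0 ≡ U N.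
    n≤zero : ∀ N → 1 ≤ N → + m ∣ℤ U N → n ≤ N
    n≤zero N 1≤N m∣UN with n ≤? N
    ... | yes n≤N = n≤N
    ... | no  n≰N = ⊥-elim (incongruent 0 N z<s (≰⇒> n≰N) (<⇒≢ 1≤N)
                     (∣⇒∣ᵤ (subst (+ m ∣ℤ_) (sym (ℤ.+-identityˡ (ℤ.- U N))) (∣m⇒∣-m m∣UN))))

    no-short-zero : ∀ N → 1 ≤ N → + m ∣ℤ U N → 2 * N ≤ m → ⊥
    no-short-zero N 1≤N m∣UN 2N≤m = <-irrefl refl (begin-strict
      m          ≤⟨ m≤2j ⟩
      2 * j      <⟨ *-monoʳ-< 2 (n<1+n j) ⟩
      2 * n      ≤⟨ *-monoʳ-≤ 2 (n≤zero N 1≤N m∣UN) ⟩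
      2 * N      ≤⟨ 2N≤m ⟩
      m          ∎)
      where open ≤-Reasoning

    -- Nor a zero at 0 < N < m where moreover A N ≡ -1: by reflection U i ≡ U j for N = i + j
    -- with i < j < n.
    no-symmetric-zero : ∀ N → 1 ≤ N → N < m → + m ∣ℤ U N → + m ∣ℤ A N ℤ.+ + 1 → ⊥
    no-symmetric-zero N 1≤N N<m m∣UN m∣AN+1 =
      incongruent i j (<-trans i<j (n<1+n j)) (n<1+n j) (<⇒≢ i<j)
        (∣⇒∣ᵤ (reflection i j (subst (λ k → + m ∣ℤ U k) (sym i+j≡N) m∣UN)
                              (subst (λ k → + m ∣ℤ A k ℤ.+ + 1) (sym i+j≡N) m∣AN+1)))
      where
      i : ℕ
      i = N ∸ j
      i+j≡N : i + j ≡ N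
      i+j≡N = m∸n+n≡m (<⇒≤ (n≤zero N 1≤N m∣UN))
      i<j : i < j
      i<j = +-cancelʳ-< j i j (begin-strict
        i + j   ≡⟨ i+j≡N ⟩
        N       <⟨ N<m ⟩
        m       ≤⟨ m≤2j ⟩
        2 * j   ≡⟨ cong (λ x → j + x) (+-identityʳ j) ⟩
        j + j   ∎)
        where open ≤-Reasoning

    module OddDivisor (h : ℕ) (pp : Prime (suc (2 * h))) (1≤h : 1 ≤ h) (p∣m : suc (2 * h) ∣ m) where

      p : ℕ
      p = suc (2 * h)

      private
        decomposition : ∃₂ λ b t → m ≡ p ^ suc b * t × ¬ p ∣ t × 0 < t
        decomposition = factorOut-∣ pp p∣m 1≤m
        b t : ℕ
        b = proj₁ decomposition
        t = proj₁ (proj₂ decomposition)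
        m≡pᵇ⁺¹t : m ≡ p ^ suc b * t
        m≡pᵇ⁺¹t = proj₁ (proj₂ (proj₂ decomposition))
        p∤t : ¬ p ∣ t
        p∤t = proj₁ (proj₂ (proj₂ (proj₂ decomposition)))
        0<t : 0 < t
        0<t = proj₂ (proj₂ (proj₂ (proj₂ decomposition)))

      open AtOddPrime h pp 1≤h using (ε; p∤2; ε≡±1; ε≡1⇒p∣U[h]; ε≡-1⇒α^[h+1]≡-1; square⇒ε≡1)

      -- Since t has a zero K ≤ t, a zero k ≤ h of p would give a zero N of m with 2N ≤ m.
      no-early-zero : ∀ k → 1 ≤ k → k ≤ h → ¬ (+ p ∣ℤ U k)
      no-early-zero k 1≤k k≤h p∣Uk = contradict (zero-below t 0<t)
        where
        contradict : (∃ λ K → 1 ≤ K × K ≤ t × + t ∣ℤ U K) → ⊥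
        contradict (K , 1≤K , K≤t , t∣UK) =
          no-short-zero (K * (p ^ b * k)) (*-mono-≤ 1≤K (*-mono-≤ (m^n>0 p b) 1≤k))
            (subst (λ v → + v ∣ℤ U (K * (p ^ b * k))) (sym m≡pᵇ⁺¹t) (zero-of-product pp p∤t b k K p∣Uk t∣UK))
            (begin
              2 * (K * (p ^ b * k))   ≡⟨ regroup K (p ^ b) k ⟩
              K * (p ^ b * (2 * k))   ≤⟨ *-mono-≤ K≤t (*-monoʳ-≤ (p ^ b) (≤-trans (*-monoʳ-≤ 2 k≤h) (n≤1+n (2 * h)))) ⟩
              t * (p ^ b * p)         ≡⟨ regroup′ t (p ^ b) p ⟩
              p * p ^ b * t           ≡⟨ sym m≡pᵇ⁺¹t ⟩
              m                       ∎)
          where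
          open ≤-Reasoning
          regroup : ∀ K P k → 2 * (K * (P * k)) ≡ K * (P * (2 * k))
          regroup = NatSolver.solve-∀
          regroup′ : ∀ t P p → t * (P * p) ≡ p * P * t
          regroup′ = NatSolver.solve-∀

      ε≢1 : ¬ (+ p ∣ℤ ε ℤ.- + 1)
      ε≢1 p∣ε-1 = no-early-zero h 1≤h ≤-refl (ε≡1⇒p∣U[h] p∣ε-1)

      ε≡-1 : + p ∣ℤ ε ℤ.+ + 1
      ε≡-1 = [ (λ p∣ε-1 → ⊥-elim (ε≢1 p∣ε-1)) , (λ p∣ε+1 → p∣ε+1) ]′ ε≡±1

      α^[h+1]≡-1 : (+ p ∣ℤ U (suc h)) × (+ p ∣ℤ A (suc h) ℤ.+ + 1)
      α^[h+1]≡-1 = ε≡-1⇒α^[h+1]≡-1 ε≡-1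

      -- Part (ii): 2 is a non-residue (a square root of 2 would force ε ≡ 1) ...
      legendre : Legendre (+ 2) p -[1+ 0 ]
      legendre = leg-non (λ p∣2 → p∤2 (∣ᵤ⇒∣ p∣2)) (λ (x , p∣x²-2) → ε≢1 (square⇒ε≡1 x (∣ᵤ⇒∣ p∣x²-2)))

      rank : IsZ p ((p + 1) / 2)
      rank = subst (IsZ p) (sym [p+1]/2≡h+1)
        ( s≤s z≤n
        , ∣⇒∣ᵤ (proj₁ α^[h+1]≡-1)
        , λ k 1≤k p∣Uk → ≰⇒> (λ k≤h → no-early-zero k 1≤k k≤h (∣ᵤ⇒∣ p∣Uk)))
        where
        [p+1]/2≡h+1 : (p + 1) / 2 ≡ suc h
        [p+1]/2≡h+1 = trans (cong (_/ 2) (double h)) (m*n/n≡m (suc h) 2)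
          where
          double : ∀ h → suc (2 * h) + 1 ≡ suc h * 2
          double = NatSolver.solve-∀

    -- Zeros kp ≤ hp + 1, kq ≤ hq + 1 of p, q and K ≤ s of s give a zero N of m with 2N ≤ m,
    -- because 2 (hp + 1)(hq + 1) ≤ p q.
    no-two-odd-primes : ∀ hp hq b c s → Prime (suc (2 * hp)) → Prime (suc (2 * hq)) → 1 ≤ hp → 1 ≤ hq →
                        ¬ suc (2 * hp) ∣ suc (2 * hq) ^ suc c * s → ¬ suc (2 * hq) ∣ s → 0 < s →
                        m ≡ suc (2 * hp) ^ suc b * (suc (2 * hq) ^ suc c * s) → ⊥
    no-two-odd-primes hp hq b c s pp pq 1≤hp 1≤hq p∤t q∤s 0<s m≡ =
      contradict (oddPrime-zero hp pp 1≤hp) (oddPrime-zero hq pq 1≤hq) (zero-below s 0<s)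
      where
      p : ℕ
      p = suc (2 * hp)
      q : ℕ
      q = suc (2 * hq)
      contradict : (∃ λ kp → 1 ≤ kp × kp ≤ suc hp × + p ∣ℤ U kp) →
                   (∃ λ kq → 1 ≤ kq × kq ≤ suc hq × + q ∣ℤ U kq) →
                   (∃ λ K → 1 ≤ K × K ≤ s × + s ∣ℤ U K) → ⊥
      contradict (kp , 1≤kp , kp≤hp+1 , p∣Ukp) (kq , 1≤kq , kq≤hq+1 , q∣Ukq) (K , 1≤K , K≤s , s∣UK) =
        no-short-zero N 1≤N m∣UN 2N≤m
        where
        Kt : ℕ
        Kt = K * (q ^ c * kq)
        N : ℕ
        N = Kt * (p ^ b * kp)
        1≤N : 1 ≤ N
        1≤N = *-mono-≤ (*-mono-≤ 1≤K (*-mono-≤ (m^n>0 q c) 1≤kq)) (*-mono-≤ (m^n>0 p b) 1≤kp)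
        m∣UN : + m ∣ℤ U N
        m∣UN = subst (λ v → + v ∣ℤ U N) (sym m≡)
                 (zero-of-product pp p∤t b kp Kt p∣Ukp (zero-of-product pq q∤s c kq K q∣Ukq s∣UK))
        2kpkq≤pq : 2 * kp * kq ≤ p * q
        2kpkq≤pq = ≤-trans (*-mono-≤ (*-monoʳ-≤ 2 kp≤hp+1) kq≤hq+1) (odd-product hp hq 1≤hp 1≤hq)
        2N≤m : 2 * N ≤ m
        2N≤m = begin
          2 * (K * (q ^ c * kq) * (p ^ b * kp))   ≡⟨ regroup K (q ^ c) kq (p ^ b) kp ⟩
          K * (q ^ c * p ^ b) * (2 * kp * kq)     ≤⟨ *-mono-≤ (*-monoˡ-≤ (q ^ c * p ^ b) K≤s) 2kpkq≤pq ⟩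
          s * (q ^ c * p ^ b) * (p * q)           ≡⟨ regroup′ s (q ^ c) (p ^ b) p q ⟩
          p * p ^ b * (q * q ^ c * s)             ≡⟨ sym m≡ ⟩
          m                                       ∎
          where
          open ≤-Reasoning
          regroup : ∀ K Q kq P kp → 2 * (K * (Q * kq) * (P * kp)) ≡ K * (Q * P) * (2 * kp * kq)
          regroup = NatSolver.solve-∀
          regroup′ : ∀ s Q P p q → s * (Q * P) * (p * q) ≡ p * P * (q * Q * s)
          regroup′ = NatSolver.solve-∀

    unique-odd-prime : ∀ hp hq → Prime (suc (2 * hp)) → Prime (suc (2 * hq)) → 1 ≤ hp → 1 ≤ hq →
                       suc (2 * hp) ∣ m → suc (2 * hq) ∣ m → suc (2 * hp) ≡ suc (2 * hq)
    unique-odd-prime hp hq pp pq 1≤hp 1≤hq p∣m q∣m with suc (2 * hp) ≟ suc (2 * hq)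
    ... | yes p≡q = p≡q
    ... | no  p≢q with factorOut-∣ pp p∣m 1≤m
    ...   | b , t , m≡pᵇ⁺¹t , p∤t , 0<t with euclidsLemma (suc (2 * hp) ^ suc b) t pq (subst (suc (2 * hq) ∣_) m≡pᵇ⁺¹t q∣m)
    ...     | inj₁ q∣pᵇ⁺¹ = ⊥-elim (p≢q (sym (primeDivisorOfPower pp pq (suc b) q∣pᵇ⁺¹)))
    ...     | inj₂ q∣t with factorOut-∣ pq q∣t 0<t
    ...       | c , s , t≡qᶜ⁺¹s , q∤s , 0<s =
      ⊥-elim (no-two-odd-primes hp hq b c s pp pq 1≤hp 1≤hq (subst (λ v → ¬ suc (2 * hp) ∣ v) t≡qᶜ⁺¹s p∤t) q∤s 0<s
                (trans m≡pᵇ⁺¹t (cong (suc (2 * hp) ^ suc b *_) t≡qᶜ⁺¹s)))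

    odd-part : ∀ r → 1 < r → ¬ 2 ∣ r → r ∣ m →
               ∃ λ h → ∃ λ b → Prime (suc (2 * h)) × 1 ≤ h × r ≡ suc (2 * h) ^ suc b
    odd-part r 1<r 2∤r r∣m with primeDivisor r 1<r
    ... | p , pp , p∣r with prime-2-or-odd pp
    ...   | inj₁ refl = ⊥-elim (2∤r p∣r)
    ...   | inj₂ (h , refl , 1≤h) with factorOut-∣ pp p∣r (<-trans z<s 1<r)
    ...     | b , s , r≡pᵇ⁺¹s , p∤s , 0<s =
      h , b , pp , 1≤h , trans r≡pᵇ⁺¹s (trans (cong (suc (2 * h) ^ suc b *_) s≡1) (*-identityʳ (suc (2 * h) ^ suc b)))
      where
      s∣r : s ∣ r
      s∣r = divides (suc (2 * h) ^ suc b) r≡pᵇ⁺¹s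
      no-prime-in-s : ∀ q → Prime q → ¬ q ∣ s
      no-prime-in-s q pq q∣s with prime-2-or-odd pq
      ... | inj₁ refl = 2∤r (∣-trans q∣s s∣r)
      ... | inj₂ (hq , refl , 1≤hq) =
        p∤s (subst (_∣ s) (unique-odd-prime hq h pq pp 1≤hq 1≤h (∣-trans (∣-trans q∣s s∣r) r∣m) (∣-trans p∣r r∣m)) q∣s)
      s≡1 : s ≡ 1
      s≡1 = noPrimeDivisor⇒≡1 s 0<s no-prime-in-s

    shape : ¬ (∃ λ k → m ≡ 2 ^ k) →
            ∃ λ a → ∃ λ h → ∃ λ b → Prime (suc (2 * h)) × 1 ≤ h × m ≡ 2 ^ a * suc (2 * h) ^ suc b
    shape not-power with factorOut prime[2] m 1≤m
    ... | a , r , m≡2ᵃr , 2∤r , 0<r with 1 <? r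
    ...   | no 1≮r = ⊥-elim (not-power (a , trans m≡2ᵃr (trans (cong (2 ^ a *_) r≡1) (*-identityʳ (2 ^ a)))))
      where
      r≡1 : r ≡ 1
      r≡1 = ≤-antisym (≮⇒≥ 1≮r) 0<r
    ...   | yes 1<r with odd-part r 1<r 2∤r (divides (2 ^ a) m≡2ᵃr)
    ...     | h , b , pp , 1≤h , r≡pᵇ⁺¹ = a , h , b , pp , 1≤h , trans m≡2ᵃr (cong (2 ^ a *_) r≡pᵇ⁺¹)

    prime-power-∣ : ∀ {p x} b → m ≡ x * p ^ suc b → p ∣ m
    prime-power-∣ {p} {x} b m≡ = subst (p ∣_) (sym m≡) (∣n⇒∣m*n x (m∣m*n (p ^ b)))

    -- m is not an odd prime power pᵇ⁺¹: for N = pᵇ (h + 1) we have U N ≡ 0 and A N ≡ -1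
    -- modulo m (lifting the zero h + 1 of p, pᵇ being odd), while N < m.
    not-odd-prime-power : ∀ h b → Prime (suc (2 * h)) → 1 ≤ h → m ≡ suc (2 * h) ^ suc b → ⊥
    not-odd-prime-power h b pp 1≤h m≡pᵇ⁺¹ =
      no-symmetric-zero N 1≤N N<m (subst (λ v → + v ∣ℤ U N) (sym m≡pᵇ⁺¹) pᵇ⁺¹∣UN)
        (subst (λ v → + v ∣ℤ A N ℤ.+ + 1) (sym m≡pᵇ⁺¹) (A+1-primePower pp p∤2 (suc b) N p∣AN+1 pᵇ⁺¹∣UN))
      where
      p : ℕ
      p = suc (2 * h)
      open AtOddPrime h pp 1≤h using (p∤2)
      open OddDivisor h pp 1≤h (prime-power-∣ {x = 1} b (trans m≡pᵇ⁺¹ (sym (*-identityˡ _)))) using (α^[h+1]≡-1)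
      N : ℕ
      N = p ^ b * suc h
      1≤N : 1 ≤ N
      1≤N = *-mono-≤ (m^n>0 p b) (s≤s z≤n)
      N<m : N < m
      N<m = begin-strict
        p ^ b * suc h   <⟨ *-monoʳ-< (p ^ b) ⦃ m^n≢0 p b ⦄ (s≤s (m<m+n h (≤-trans 1≤h (m≤m+n h 0)))) ⟩
        p ^ b * p       ≡⟨ *-comm (p ^ b) p ⟩
        p * p ^ b       ≡⟨ sym m≡pᵇ⁺¹ ⟩
        m               ∎
        where open ≤-Reasoning
      pᵇ⁺¹∣UN : + (p ^ suc b) ∣ℤ U N
      pᵇ⁺¹∣UN = power-lift (suc h) (proj₁ α^[h+1]≡-1) b
      p∣AN+1 : + p ∣ℤ A N ℤ.+ + 1
      p∣AN+1 with odd-^ h b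
      ... | j , pᵇ≡2j+1 = subst (λ v → + p ∣ℤ A (v * suc h) ℤ.+ + 1) (sym pᵇ≡2j+1)
                            (A+1-oddMultiple (suc h) j (proj₁ α^[h+1]≡-1) (proj₂ α^[h+1]≡-1))

    -- For p ≡ 3 (mod 8) the zero h + 1 = 2 (2t + 1) of p is even, so m = 2ᵃ⁺¹ pᵇ⁺¹ has the
    -- zero N = 2ᵃ pᵇ (h + 1) (both 2ᵃ⁺¹ and pᵇ⁺¹ divide U N), and 2N ≤ m.
    not-3-mod-8 : ∀ a h b t → Prime (suc (2 * h)) → 1 ≤ h → h ≡ 4 * t + 1 →
                  m ≡ 2 ^ suc a * suc (2 * h) ^ suc b → ⊥
    not-3-mod-8 a h b t pp 1≤h h≡4t+1 m≡ = no-short-zero N 1≤N m∣UN 2N≤m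
      where
      p : ℕ
      p = suc (2 * h)
      open OddDivisor h pp 1≤h (prime-power-∣ {x = 2 ^ suc a} b m≡) using (α^[h+1]≡-1)
      N : ℕ
      N = 2 ^ a * (p ^ b * suc h)
      1≤N : 1 ≤ N
      1≤N = *-mono-≤ (m^n>0 2 a) (*-mono-≤ (m^n>0 p b) (s≤s z≤n))
      pᵇ⁺¹∣UN : + (p ^ suc b) ∣ℤ U N
      pᵇ⁺¹∣UN = ∣U-multiple (p ^ b * suc h) (2 ^ a) (power-lift (suc h) (proj₁ α^[h+1]≡-1) b)
      2ᵃ⁺¹∣UN : + (2 ^ suc a) ∣ℤ U N
      2ᵃ⁺¹∣UN = subst (λ v → + (2 ^ suc a) ∣ℤ U v) N≡ (∣U-multiple (2 ^ suc a) (p ^ b * (2 * t + 1)) (2^a∣U[2^a] (suc a)))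
        where
        N≡ : p ^ b * (2 * t + 1) * 2 ^ suc a ≡ N
        N≡ = trans (regroup (p ^ b) t (2 ^ a)) (cong (λ v → 2 ^ a * (p ^ b * v)) (sym (cong suc h≡4t+1)))
          where
          regroup : ∀ P t x → P * (2 * t + 1) * (2 * x) ≡ x * (P * suc (4 * t + 1))
          regroup = NatSolver.solve-∀
      p∤2ᵃ⁺¹ : ¬ p ∣ 2 ^ suc a
      p∤2ᵃ⁺¹ p∣2ᵃ⁺¹ = >⇒≢ (s≤s (*-monoʳ-≤ 2 1≤h)) (primeDivisorOfPower prime[2] pp (suc a) p∣2ᵃ⁺¹)
      m∣UN : + m ∣ℤ U N
      m∣UN = subst (λ v → + v ∣ℤ U N) (trans (*-comm (p ^ suc b) (2 ^ suc a)) (sym m≡))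
               (primePower-∣-productℤ pp p∤2ᵃ⁺¹ (suc b) pᵇ⁺¹∣UN 2ᵃ⁺¹∣UN)
      2N≤m : 2 * N ≤ m
      2N≤m = begin
        2 * (2 ^ a * (p ^ b * suc h))   ≡⟨ sym (*-assoc 2 (2 ^ a) (p ^ b * suc h)) ⟩
        2 ^ suc a * (p ^ b * suc h)     ≤⟨ *-monoʳ-≤ (2 ^ suc a) (*-monoʳ-≤ (p ^ b) (s≤s (m≤m+n h _))) ⟩
        2 ^ suc a * (p ^ b * p)         ≡⟨ cong (2 ^ suc a *_) (*-comm (p ^ b) p) ⟩
        2 ^ suc a * p ^ suc b           ≡⟨ sym m≡ ⟩
        m                               ∎
        where open ≤-Reasoning

    part-i : ∀ p q → OddPrime p → OddPrime q → p ∣ m → q ∣ m → p ≡ q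
    part-i p q op oq p∣m q∣m with oddPrime⇒2h+1 op | oddPrime⇒2h+1 oq
    ... | hp , refl , 1≤hp | hq , refl , 1≤hq = unique-odd-prime hp hq (proj₁ op) (proj₁ oq) 1≤hp 1≤hq p∣m q∣m

    part-ii : ∀ p → OddPrime p → p ∣ m → Legendre (+ 2) p -[1+ 0 ] × IsZ p ((p + 1) / 2)
    part-ii p op p∣m with oddPrime⇒2h+1 op
    ... | h , refl , 1≤h = OddDivisor.legendre h (proj₁ op) 1≤h p∣m , OddDivisor.rank h (proj₁ op) 1≤h p∣m

    -- Part (iii): in m = 2ᵃ pᵇ⁺¹ we have a ≥ 1, and p ≡ 5 (mod 8) since p ≡ ±1 would give
    -- 2ʰ ≡ 1 (excluded by part (ii)) and p ≡ 3 is excluded by not-3-mod-8.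
    part-iii : ¬ (∃ λ k → m ≡ 2 ^ k) →
               ∃ λ a → ∃ λ b → ∃ λ p → 1 ≤ a × 1 ≤ b × Prime p × p % 8 ≡ 5 × m ≡ 2 ^ a * p ^ b
    part-iii not-power with shape not-power
    ... | zero  , h , b , pp , 1≤h , m≡ = ⊥-elim (not-odd-prime-power h b pp 1≤h (trans m≡ (+-identityʳ _)))
    ... | suc a , h , b , pp , 1≤h , m≡ with residue-mod-4 h
    ...   | t , inj₁ refl =
      ⊥-elim (OddDivisor.ε≢1 (4 * t) pp 1≤h (prime-power-∣ {x = 2 ^ suc a} b m≡) (Gaussian.2^h≡1-if-p≡1[mod8] t pp))
    ...   | t , inj₂ (inj₁ h≡4t+1) = ⊥-elim (not-3-mod-8 a h b t pp 1≤h h≡4t+1 m≡)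
    ...   | t , inj₂ (inj₂ (inj₁ refl)) = suc a , suc b , _ , s≤s z≤n , s≤s z≤n , pp , p%8≡5 , m≡
      where
      p%8≡5 : suc (2 * (4 * t + 2)) % 8 ≡ 5
      p%8≡5 = trans (cong (_% 8) (expand t)) ([m+kn]%n≡m%n 5 t 8)
        where
        expand : ∀ t → suc (2 * (4 * t + 2)) ≡ 5 + t * 8
        expand = NatSolver.solve-∀
    ...   | t , inj₂ (inj₂ (inj₂ refl)) =
      ⊥-elim (OddDivisor.ε≢1 (4 * t + 3) pp 1≤h (prime-power-∣ {x = 2 ^ suc a} b m≡) (Gaussian.2^h≡1-if-p≡7[mod8] t pp))

open import Data.Nat using (ℕ; suc; s≤s; _<_; _≤_; _^_; _*_; _/_; _%_; _+_)
open import Data.Integer using (+_; -[1+_])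
open import Data.Nat.Divisibility using (_∣_)
open import Data.Nat.Primality using (Prime)
open import Data.Product using (∃; _×_; _,_)
open import Relation.Nullary using (¬_)
open import Relation.Binary.PropositionalEquality using (_≡_)

lemma6 : ∀ (n m : ℕ) → 1 < n → IsD₁ n m →
           (∀ p q → OddPrime p → OddPrime q → p ∣ m → q ∣ m → p ≡ q)
         × (∀ p → OddPrime p → p ∣ m → (∀ q → OddPrime q → q ∣ m → q ≡ p) →
              Legendre (+ 2) p -[1+ 0 ] × IsZ p ((p + 1) / 2))
         × (¬ (∃ λ k → m ≡ 2 ^ k) →
              ∃ λ a → ∃ λ b → ∃ λ p → 1 ≤ a × 1 ≤ b × Prime p × p % 8 ≡ 5
                × m ≡ 2 ^ a * p ^ b)
lemma6 (suc j) m (s≤s 1≤j) isD₁ =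
    part-i j m 1≤j isD₁
  , (λ p op p∣m _ → part-ii j m 1≤j isD₁ p op p∣m)
  , part-iii j m 1≤j isD₁
  where open MinimalModulus using (part-i; part-ii; part-iii)
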